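{- Let $G$ be a block graph. Then the dispensing number of $G$ is the sum of the dispensing numbers of the cliques of $G$ (its blocks): if these are $K_{n_1},\dots,K_{n_l}$, then $\vartheta(G)=\sum_{i=1}^{l}\vartheta(K_{n_i})$.
   Context: A block graph (clique tree) is an undirected graph in which every biconnected component (block) is a clique. An integer additive set-indexer (IASI) of a graph $G$ is an injective map $f:V(G)\to\mathcal{P}(\mathbb{N}_0)$ (finite subsets of non-negative integers) such that $f^+(uv)=f(u)+f(v)=\{a+b:a\in f(u),b\in f(v)\}$ is injective on $E(G)$. An AP-set is a set of at least three non-negative integers in arithmetic progression; its common difference is its deterministic index. An arithmetic IASI is an IASI for which all vertex and edge set-labels are AP-sets. For an edge, the integer ratio between the deterministic indices of its end vertices (larger over smaller) is its deterministic ratio. The dispensing number $\vartheta(G)$ is the minimum possible number of edges of $G$ that do not have a prime deterministic ratio (minimum over arithmetic IASIs of $G$). -}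

module Defs where

open import Data.Nat using (ℕ; zero; suc; _+_; _*_; _≤_; _<_; _<ᵇ_)
open import Data.Nat.Primality using (Prime)
open import Data.Bool using (Bool; true; false; _∧_; if_then_else_)
open import Data.Fin using (Fin; toℕ)
open import Data.Fin.Subset using (Subset; _∈_; _⊆_; _-_; Nonempty)
open import Data.List using (List; []; _∷_; concatMap; allFin)
open import Data.Product using (Σ; ∃; _×_; _,_)
open import Data.Sum using (_⊎_)
open import Relation.Binary.PropositionalEquality using (_≡_; _≢_)
open import Relation.Nullary using (¬_)

record Graph : Set where
  field
    n     : ℕ
    adj   : Fin n → Fin n → Bool
    sym   : ∀ u v → adj u v ≡ adj v u
    irrefl : ∀ v → adj v v ≡ false
open Graph public

Adj : (G : Graph) → Fin (n G) → Fin (n G) → Set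
Adj G u v = adj G u v ≡ true

complete : ℕ → Graph
complete m = record
  { n = m ; adj = λ u v → neq u v ; sym = symNeq ; irrefl = irrNeq }
  where
  neq : ∀ {k} → Fin k → Fin k → Bool
  neq Fin.zero Fin.zero = false
  neq Fin.zero (Fin.suc _) = true
  neq (Fin.suc _) Fin.zero = true
  neq (Fin.suc a) (Fin.suc b) = neq a b
  symNeq : ∀ {k} (a b : Fin k) → neq a b ≡ neq b a
  symNeq Fin.zero Fin.zero = _≡_.refl
  symNeq Fin.zero (Fin.suc _) = _≡_.refl
  symNeq (Fin.suc _) Fin.zero = _≡_.refl
  symNeq (Fin.suc a) (Fin.suc b) = symNeq a b
  irrNeq : ∀ {k} (a : Fin k) → neq a a ≡ false
  irrNeq Fin.zero = _≡_.refl
  irrNeq (Fin.suc a) = irrNeq a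

-- list of edges, each unordered edge {u,v} listed once as (u , v) with u < v
edges : (G : Graph) → List (Fin (n G) × Fin (n G))
edges G = concatMap (λ u → concatMap (λ v →
            if adj G u v ∧ (toℕ u <ᵇ toℕ v) then (u , v) ∷ [] else [])
          (allFin (n G))) (allFin (n G))

data Reach (G : Graph) (S : Subset (n G)) (u : Fin (n G)) : Fin (n G) → Set where
  here : u ∈ S → Reach G S u u
  step : ∀ {w v} → Reach G S u w → Adj G w v → v ∈ S → Reach G S u v

-- the subgraph induced by S is connected (vacuously for empty S)
Connected : (G : Graph) → Subset (n G) → Set
Connected G S = ∀ u v → u ∈ S → v ∈ S → Reach G S u v

Nonseparable : (G : Graph) → Subset (n G) → Set
Nonseparable G S = Nonempty S × Connected G S × (∀ v → v ∈ S → Connected G (S - v))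

IsBlock : (G : Graph) → Subset (n G) → Set
IsBlock G B = Nonseparable G B × (∀ C → B ⊆ C → Nonseparable G C → C ⊆ B)

IsClique : (G : Graph) → Subset (n G) → Set
IsClique G B = ∀ u v → u ∈ B → v ∈ B → u ≢ v → Adj G u v

IsBlockGraph : Graph → Set
IsBlockGraph G = ∀ B → IsBlock G B → IsClique G B

IsBlockList : (G : Graph) → List (Subset (n G)) → Set
IsBlockList G Bs =
  (∀ B → B Data.List.Membership.Propositional.∈ Bs → IsBlock G B) ×
  (∀ B → IsBlock G B → B Data.List.Membership.Propositional.∈ Bs) ×
  Data.List.Relation.Unary.Unique.Propositional.Unique Bs
  where
  import Data.List.Membership.Propositional
  import Data.List.Relation.Unary.Unique.Propositional

SetN : Set₁
SetN = ℕ → Set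

_≐_ : SetN → SetN → Set
A ≐ B = ∀ x → (A x → B x) × (B x → A x)

_⊕_ : SetN → SetN → SetN
(A ⊕ B) x = ∃ λ a → ∃ λ b → A a × B b × x ≡ a + b

record AP : Set where
  field
    start : ℕ
    diff  : ℕ
    len   : ℕ
    diff≥1 : 1 ≤ diff
    len≥3  : 3 ≤ len
open AP public

⟦_⟧ : AP → SetN
⟦ A ⟧ x = ∃ λ i → i < len A × x ≡ start A + i * diff A

IsAPSet : SetN → Set
IsAPSet X = ∃ λ (A : AP) → ⟦ A ⟧ ≐ X

-- An arithmetic IASI: every vertex set-label is an AP-set (given here
-- by its progression data, which determines it uniquely), vertex labels
-- are distinct, every edge label f(u)+f(v) is an AP-set, and distinct
-- edges get distinct labels.
record ArithIASI (G : Graph) : Set where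
  field
    f : Fin (n G) → AP
    vinj : ∀ u v → u ≢ v → ¬ (⟦ f u ⟧ ≐ ⟦ f v ⟧)
    edgeAP : ∀ u v → Adj G u v → IsAPSet (⟦ f u ⟧ ⊕ ⟦ f v ⟧)
    einj : ∀ u v u' v' → Adj G u v → Adj G u' v' →
           ¬ ((u ≡ u' × v ≡ v') ⊎ (u ≡ v' × v ≡ u')) →
           ¬ ((⟦ f u ⟧ ⊕ ⟦ f v ⟧) ≐ (⟦ f u' ⟧ ⊕ ⟦ f v' ⟧))
open ArithIASI public

PrimeRatio : AP → AP → Set
PrimeRatio A B = ∃ λ p → Prime p × (diff B ≡ p * diff A ⊎ diff A ≡ p * diff B)

data NPCount {G : Graph} (F : ArithIASI G) : List (Fin (n G) × Fin (n G)) → ℕ → Set where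
  nil  : NPCount F [] 0
  prm  : ∀ {u v es k} → PrimeRatio (f F u) (f F v) →
         NPCount F es k → NPCount F ((u , v) ∷ es) k
  nprm : ∀ {u v es k} → ¬ PrimeRatio (f F u) (f F v) →
         NPCount F es k → NPCount F ((u , v) ∷ es) (suc k)

IsDispensingNumber : Graph → ℕ → Set
IsDispensingNumber G k =
  (Σ (ArithIASI G) λ F → NPCount F (edges G) k) ×
  (∀ (F : ArithIASI G) j → NPCount F (edges G) j → k ≤ j)

module Submission where

-- Every edge lies in exactly one block and every block is a clique, so the
-- number of non-prime edges of an arithmetic IASI of G is the sum of those numbers for its
-- restrictions to the blocks; each restriction is an arithmetic IASI of a complete graph,
-- hence contributes at least the dispensing number of that complete graph.
--
-- Fix optimal labellings of the blocks. Every vertex w hangs off a block B at a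
-- single vertex of B (a second one would give a detour around B, contradicting maximality).
-- Label w by the progression starting at 2^w whose difference is the product, over all
-- blocks B, of the difference B's labelling gives to that vertex. Along an edge of a block
-- B₀ all other blocks contribute equal factors to both ends, so the ratio of differences is
-- the one in B₀: sumsets remain AP-sets and prime ratios are preserved. The starts 2^w make
-- vertex and edge labels injective, as powers of two form a Sidon set.

open import Defs
open import Data.Nat using (ℕ; zero; suc; _+_; _*_; _∸_; _^_; _≤_; _<_; z≤n; s≤s; _<?_; _<ᵇ_; _≟_; >-nonZero)
open import Data.Nat.Properties
open import Data.Nat.Divisibility using (_∣_; divides; ∣⇒≤)
open import Data.Nat.Primality using (Prime; prime?)
open import Data.Nat.ListAction using (sum)
open import Data.Nat.Tactic.RingSolver using (solve-∀)
open import Algebra.Properties.CommutativeSemigroup +-commutativeSemigroup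
  using () renaming (interchange to +-interchange; x∙yz≈y∙xz to x+[y+z]≡y+[x+z];
                     xy∙z≈xz∙y to [x+y]+z≡[x+z]+y)
open import Algebra.Properties.CommutativeSemigroup *-commutativeSemigroup
  using () renaming (x∙yz≈y∙xz to x*[y*z]≡y*[x*z])
open import Algebra.Properties.Semiring.Sum +-*-semiring
  using (sum-syntax; sum-cong-≗; ∑-distrib-+; *-distribˡ-sum)
open import Data.Bool using (Bool; true; false; _∧_; if_then_else_; T)
open import Data.Bool.Properties using (T-∧; ∧-zeroʳ; ∧-identityʳ) renaming (_≟_ to _≟ᵇ_)
open import Data.Fin using (Fin; zero; suc; toℕ; fromℕ<)
import Data.Fin.Properties as Finₚ
open import Data.Fin.Subset
  using (Subset; _∈_; _∉_; _⊆_; _⊂_; _⊃_; _-_; _∪_; ∁; ⁅_⁆; ∣_∣) renaming (⊥ to ∅)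
open import Data.Fin.Subset.Properties
  using (_∈?_; _⊆?_; nonempty?; anySubset?; x∈p∧x≢y⇒x∈p-y; p─q⊆p; x∈p⇒p-x⊂p;
         x∈p∪q⁻; x∈p∪q⁺; p⊆p∪q; q⊆p∪q;
         ⊆-antisym; x∈⁅x⁆; x∈⁅y⁆⇒x≡y; ∉⊥; x∈∁p⇒x∉p; x∉p⇒x∈∁p)
open import Data.Fin.Subset.Induction using (⊂-wellFounded; ⊃-wellFounded)
open import Induction.WellFounded using (Acc; acc)
open import Data.Vec using ([]; _∷_; here; there; lookup)
open import Data.Vec.Properties using ([]=⇒lookup; lookup⇒[]=)
open import Data.List using (List; []; _∷_; _++_; reverse; map; concatMap; tabulate; allFin)
open import Data.List.Properties using (unfold-reverse)
open import Data.List.Membership.Propositional using () renaming (_∈_ to _∈L_; _∉_ to _∉L_)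
open import Data.List.Membership.Propositional.Properties
  using (∈-∃++; ∈-++⁺ˡ; ∈-++⁺ʳ; ∈-++⁻; ∈-map⁺; ∈-map⁻)
open import Data.List.Relation.Unary.Any using () renaming (here to hereL; there to thereL)
import Data.List.Relation.Unary.Any.Properties as Anyₚ
open import Data.List.Relation.Unary.All using ([]; _∷_) renaming (lookup to lookupᴬ)
open import Data.List.Relation.Unary.All.Properties using (++⁻ʳ; All¬⇒¬Any; ¬Any⇒All¬)
open import Data.List.Relation.Unary.AllPairs using ([]; _∷_)
open import Data.List.Relation.Unary.Unique.Propositional using (Unique)
open import Data.List.Relation.Binary.Subset.Propositional using () renaming (_⊆_ to _⊆L_)
open import Data.List.Relation.Binary.Subset.Propositional.Properties using (∷⁺ʳ; ⊆-trans; xs⊆ys++xs)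
open import Data.List.Relation.Binary.Pointwise using (Pointwise; []; _∷_)
open import Data.Maybe using (Maybe; just; nothing)
import Data.Maybe as Maybe
open import Data.Product using (Σ; _×_; _,_; proj₁; proj₂)
open import Data.Sum using (_⊎_; inj₁; inj₂)
open import Data.Empty using (⊥; ⊥-elim)
open import Function using (_∘_)
open import Function.Bundles using (Equivalence)
open import Relation.Nullary using (¬_; Dec; yes; no; does)
open import Relation.Nullary.Decidable using (_×-dec_; _⊎-dec_; _→-dec_; ¬?; map′)
open import Relation.Binary.Definitions using (tri<; tri≈; tri>)
open import Relation.Binary.PropositionalEquality
  using (_≡_; _≢_; ≢-sym; refl; cong; cong₂; subst; trans; module ≡-Reasoning) renaming (sym to ≡-sym)

start∈ : (A : AP) → ⟦ A ⟧ (start A)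
start∈ A = 0 , ≤-trans (s≤s z≤n) (len≥3 A) , ≡-sym (+-identityʳ (start A))

second∈ : (A : AP) → ⟦ A ⟧ (start A + diff A)
second∈ A = 1 , ≤-trans (s≤s (s≤s z≤n)) (len≥3 A) , cong (start A +_) (≡-sym (*-identityˡ (diff A)))

start-min : (A : AP) → ∀ x → ⟦ A ⟧ x → start A ≤ x
start-min A x (i , _ , refl) = m≤m+n _ _

offset-multiple : (A : AP) → ∀ d → ⟦ A ⟧ (start A + d) → (diff A ∣ d)
offset-multiple A d (i , _ , eq) = divides i (+-cancelˡ-≡ (start A) d (i * diff A) eq)

≐⇒start≡ : (A B : AP) → ⟦ A ⟧ ≐ ⟦ B ⟧ → start A ≡ start B
≐⇒start≡ A B e = ≤-antisym (start-min A _ (proj₂ (e (start B)) (start∈ B)))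
                            (start-min B _ (proj₁ (e (start A)) (start∈ A)))

⊕-start∈ : (A B : AP) → (⟦ A ⟧ ⊕ ⟦ B ⟧) (start A + start B)
⊕-start∈ A B = start A , start B , start∈ A , start∈ B , refl

⊕-start-min : (A B : AP) → ∀ x → (⟦ A ⟧ ⊕ ⟦ B ⟧) x → start A + start B ≤ x
⊕-start-min A B x (a , b , a∈ , b∈ , refl) = +-mono-≤ (start-min A a a∈) (start-min B b b∈)

-- Equal sumsets have equal minima; this is what makes edge labels injective later.
⊕≐⇒start≡ : (A B A' B' : AP) → (⟦ A ⟧ ⊕ ⟦ B ⟧) ≐ (⟦ A' ⟧ ⊕ ⟦ B' ⟧) →
            start A + start B ≡ start A' + start B'
⊕≐⇒start≡ A B A' B' e = ≤-antisym
  (⊕-start-min A B _ (proj₂ (e _) (⊕-start∈ A' B')))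
  (⊕-start-min A' B' _ (proj₁ (e _) (⊕-start∈ A B)))

⊕-comm : (X Y : SetN) → (X ⊕ Y) ≐ (Y ⊕ X)
⊕-comm X Y x = swap , swap
  where
  swap : ∀ {X Y : SetN} → (X ⊕ Y) x → (Y ⊕ X) x
  swap (a , b , a∈ , b∈ , e) = b , a , b∈ , a∈ , trans e (+-comm a b)

≐-trans : {X Y Z : SetN} → X ≐ Y → Y ≐ Z → X ≐ Z
≐-trans e1 e2 x = (λ p → proj₁ (e2 x) (proj₁ (e1 x) p)) , (λ p → proj₂ (e1 x) (proj₂ (e2 x) p))

-- If c divides a and b, and c = i·a + j·b, then a or b equals c, so one of a, b
-- divides the other.
common-divisor-combination : ∀ {a b c} i j → 1 ≤ a → 1 ≤ b → 1 ≤ c →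
  (c ∣ a) → (c ∣ b) → c ≡ i * a + j * b → (a ∣ b) ⊎ (b ∣ a)
common-divisor-combination zero zero _ _ c≥1 _ _ refl = ⊥-elim (<⇒≢ c≥1 refl)
common-divisor-combination {a} {b} (suc i) j a≥1 _ _ c∣a c∣b refl =
  inj₁ (subst (_∣ b) (≡-sym a≡c) c∣b)
  where
  a≡c : a ≡ suc i * a + j * b
  a≡c = ≤-antisym (≤-trans (m≤m+n a (i * a)) (m≤m+n _ (j * b))) (∣⇒≤ ⦃ >-nonZero a≥1 ⦄ c∣a)
common-divisor-combination {a} {b} zero (suc j) _ b≥1 _ c∣a c∣b refl =
  inj₂ (subst (_∣ a) (≡-sym b≡c) c∣a)
  where
  b≡c : b ≡ suc j * b
  b≡c = ≤-antisym (m≤m+n b (j * b)) (∣⇒≤ ⦃ >-nonZero b≥1 ⦄ c∣b)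

sumAP⇒diff∣diff : (A B : AP) → IsAPSet (⟦ A ⟧ ⊕ ⟦ B ⟧) → (diff A ∣ diff B) ⊎ (diff B ∣ diff A)
sumAP⇒diff∣diff A B (C , e) with proj₁ (e (start C + diff C)) (second∈ C)
... | _ , _ , (i , _ , refl) , (j , _ , refl) , c-eq =
  common-divisor-combination i j (diff≥1 A) (diff≥1 B) (diff≥1 C) c∣a c∣b c≡ia+jb
  where
  sA = start A ; sB = start B ; a = diff A ; b = diff B ; c = diff C
  sC≡ : start C ≡ sA + sB
  sC≡ = ≤-antisym (start-min C _ (proj₂ (e _) (⊕-start∈ A B))) (⊕-start-min A B _ (proj₁ (e _) (start∈ C)))
  shifted : ∀ d → (⟦ A ⟧ ⊕ ⟦ B ⟧) (sA + sB + d) → (c ∣ d)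
  shifted d p = offset-multiple C d (subst (λ s → ⟦ C ⟧ (s + d)) (≡-sym sC≡) (proj₂ (e _) p))
  c∣a : c ∣ a
  c∣a = shifted a (sA + a , sB , second∈ A , start∈ B , [x+y]+z≡[x+z]+y sA sB a)
  c∣b : c ∣ b
  c∣b = shifted b (sA , sB + b , start∈ A , second∈ B , +-assoc sA sB b)
  c≡ia+jb : c ≡ i * a + j * b
  c≡ia+jb = +-cancelˡ-≡ (sA + sB) c (i * a + j * b) (begin
    sA + sB + c                     ≡⟨ cong (_+ c) (≡-sym sC≡) ⟩
    start C + c                     ≡⟨ c-eq ⟩
    sA + i * a + (sB + j * b)       ≡⟨ +-interchange sA (i * a) sB (j * b) ⟩
    sA + sB + (i * a + j * b)       ∎)
    where open ≡-Reasoning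

-- Mixed-radix splitting: if k ≤ l, every m < l + t·k is i + j·k with i < l and j ≤ t.
split-index : ∀ l k → k ≤ l → ∀ t m → m < l + t * k →
              Σ ℕ λ i → Σ ℕ λ j → i < l × j ≤ t × m ≡ i + j * k
split-index l k k≤l zero m m< = m , 0 , subst (m <_) (+-identityʳ l) m< , z≤n , ≡-sym (+-identityʳ m)
split-index l k k≤l (suc t) m m< with m <? l
... | yes m<l = m , 0 , m<l , z≤n , ≡-sym (+-identityʳ m)
... | no m≮l with m≤n⇒∃[o]m+o≡n (≤-trans k≤l (≮⇒≥ m≮l))
...   | m' , refl with split-index l k k≤l t m' m'<
  where
  m'< : m' < l + t * k
  m'< = +-cancelˡ-< k m' (l + t * k) (subst (k + m' <_) (x+[y+z]≡y+[x+z] l k (t * k)) m<)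
...     | i , j , i<l , j≤t , refl = i , suc j , i<l , s≤s j≤t , x+[y+z]≡y+[x+z] k i (j * k)

-- If diff B = k · diff A with k ≤ len A, then A ⊕ B is an AP-set: the progression
-- with start start A + start B, difference diff A and length len A + (len B ∸ 1)·k.
sumAP-of-multiple : (A B : AP) (k : ℕ) → diff B ≡ k * diff A → k ≤ len A → IsAPSet (⟦ A ⟧ ⊕ ⟦ B ⟧)
sumAP-of-multiple A B k b≡ka k≤len = C , λ x → to x , from x
  where
  a = diff A
  C : AP
  C = record { start = start A + start B ; diff = a ; len = len A + (len B ∸ 1) * k
             ; diff≥1 = diff≥1 A ; len≥3 = ≤-trans (len≥3 A) (m≤m+n _ _) }
  regroup : ∀ sa sb i j k a → sa + i * a + (sb + j * (k * a)) ≡ sa + sb + (i + j * k) * a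
  regroup = solve-∀
  pair-sum : ∀ i j → start A + i * a + (start B + j * diff B) ≡ start C + (i + j * k) * a
  pair-sum i j = trans (cong (λ q → start A + i * a + (start B + j * q)) b≡ka) (regroup (start A) (start B) i j k a)
  j<lenB : ∀ {j} → j ≤ len B ∸ 1 → j < len B
  j<lenB = m≤pred[n]⇒suc[m]≤n ⦃ >-nonZero (≤-trans (s≤s z≤n) (len≥3 B)) ⦄
  from : ∀ x → (⟦ A ⟧ ⊕ ⟦ B ⟧) x → ⟦ C ⟧ x
  from x (_ , _ , (i , i< , refl) , (j , j< , refl) , refl) =
    i + j * k , +-mono-<-≤ i< (*-monoˡ-≤ k (suc[m]≤n⇒m≤pred[n] j<)) , pair-sum i j
  to : ∀ x → ⟦ C ⟧ x → (⟦ A ⟧ ⊕ ⟦ B ⟧) x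
  to x (m , m< , refl) with split-index (len A) k k≤len (len B ∸ 1) m m<
  ... | i , j , i< , j≤ , refl = _ , _ , (i , i< , refl) , (j , j<lenB j≤ , refl) , ≡-sym (pair-sum i j)

sumAP-of-multiple' : (A B : AP) (k : ℕ) → diff A ≡ k * diff B → k ≤ len B → IsAPSet (⟦ A ⟧ ⊕ ⟦ B ⟧)
sumAP-of-multiple' A B k a≡kb k≤len with sumAP-of-multiple B A k a≡kb k≤len
... | C , e = C , ≐-trans e (⊕-comm ⟦ B ⟧ ⟦ A ⟧)

Odd : ℕ → Set
Odd o = Σ ℕ λ q → o ≡ suc (2 * q)

2-adic-unique : ∀ a c {o o'} → Odd o → Odd o' → 2 ^ a * o ≡ 2 ^ c * o' → a ≡ c
2-adic-unique zero    zero    _        _         _ = refl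
2-adic-unique zero    (suc c) (q , refl) _       e =
  ⊥-elim (even≢odd (2 ^ c * _) q (≡-sym (trans (≡-sym (+-identityʳ _)) (trans e (*-assoc 2 (2 ^ c) _)))))
2-adic-unique (suc a) zero    _        (q , refl) e =
  ⊥-elim (even≢odd (2 ^ a * _) q (trans (≡-sym (*-assoc 2 (2 ^ a) _)) (trans e (+-identityʳ _))))
2-adic-unique (suc a) (suc c) odd-o    odd-o'    e = cong suc (2-adic-unique a c odd-o odd-o'
  (*-cancelˡ-≡ _ _ 2 (trans (≡-sym (*-assoc 2 (2 ^ a) _)) (trans e (*-assoc 2 (2 ^ c) _)))))

2^-injective : ∀ a c → 2 ^ a ≡ 2 ^ c → a ≡ c
2^-injective a c e = 2-adic-unique a c (0 , refl) (0 , refl) (trans (*-identityʳ _) (trans e (≡-sym (*-identityʳ _))))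

pow-sum-factor : ∀ a e → 2 ^ a + 2 ^ (suc a + e) ≡ 2 ^ a * suc (2 * 2 ^ e)
pow-sum-factor a e = begin
  2 ^ a + 2 ^ (suc a + e)     ≡⟨ cong (2 ^ a +_) (^-distribˡ-+-* 2 (suc a) e) ⟩
  2 ^ a + 2 * 2 ^ a * 2 ^ e   ≡⟨ factor (2 ^ a) (2 ^ e) ⟩
  2 ^ a * suc (2 * 2 ^ e)     ∎
  where
  open ≡-Reasoning
  factor : ∀ x y → x + 2 * x * y ≡ x * (1 + 2 * y)
  factor = solve-∀

sidon-ordered : ∀ a b c d → a < b → c < d → 2 ^ a + 2 ^ b ≡ 2 ^ c + 2 ^ d → a ≡ c × b ≡ d
sidon-ordered a b c d a<b c<d eq
  with e1 , refl ← m≤n⇒∃[o]m+o≡n a<b | e2 , refl ← m≤n⇒∃[o]m+o≡n c<d = a≡c , b≡d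
  where
  a≡c : a ≡ c
  a≡c = 2-adic-unique a c (2 ^ e1 , refl) (2 ^ e2 , refl)
          (trans (≡-sym (pow-sum-factor a e1)) (trans eq (pow-sum-factor c e2)))
  b≡d : suc a + e1 ≡ suc c + e2
  b≡d = 2^-injective _ _ (+-cancelˡ-≡ (2 ^ a) _ _ (trans eq (cong (λ q → 2 ^ q + 2 ^ (suc c + e2)) (≡-sym a≡c))))

sidon : ∀ a b c d → a ≢ b → c ≢ d → 2 ^ a + 2 ^ b ≡ 2 ^ c + 2 ^ d →
        (a ≡ c × b ≡ d) ⊎ (a ≡ d × b ≡ c)
sidon a b c d a≢b c≢d eq with <-cmp a b | <-cmp c d
... | tri≈ _ a≡b _ | _ = ⊥-elim (a≢b a≡b)
... | _ | tri≈ _ c≡d _ = ⊥-elim (c≢d c≡d)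
... | tri< a<b _ _ | tri< c<d _ _ = inj₁ (sidon-ordered a b c d a<b c<d eq)
... | tri< a<b _ _ | tri> _ _ d<c
  with a≡d , b≡c ← sidon-ordered a b d c a<b d<c (trans eq (+-comm (2 ^ c) _)) = inj₂ (a≡d , b≡c)
... | tri> _ _ b<a | tri< c<d _ _
  with b≡c , a≡d ← sidon-ordered b a c d b<a c<d (trans (+-comm (2 ^ b) _) eq) = inj₂ (a≡d , b≡c)
... | tri> _ _ b<a | tri> _ _ d<c
  with b≡d , a≡c ← sidon-ordered b a d c b<a d<c (trans (+-comm (2 ^ b) _) (trans eq (+-comm (2 ^ c) _))) =
  inj₁ (a≡c , b≡d)

unique-drop : ∀ {X : Set} (a : List X) {c} → Unique (a ++ c) → Unique c
unique-drop []      u       = u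
unique-drop (_ ∷ a) (_ ∷ u) = unique-drop a u

unique-split : ∀ {X : Set} a (z : X) c → Unique (a ++ z ∷ c) → z ∉L a × z ∉L c
unique-split []      z c (z∉c ∷ _) = (λ ()) , All¬⇒¬Any z∉c
unique-split (q ∷ a) z c (q∉ ∷ u) = z∉q∷a , proj₂ (unique-split a z c u)
  where
  z∉q∷a : z ∉L (q ∷ a)
  z∉q∷a (hereL refl) with ++⁻ʳ a q∉
  ... | q≢q ∷ _ = q≢q refl
  z∉q∷a (thereL z∈a) = proj₁ (unique-split a z c u) z∈a

first : ∀ {m} {P : Fin m → Set} → (∀ i → Dec (P i)) → Maybe (Fin m)
first {zero}  P? = nothing
first {suc m} P? with P? zero
... | yes _ = just zero
... | no _  = Maybe.map suc (first (P? ∘ suc))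

first-unique : ∀ {m} {P : Fin m → Set} (P? : ∀ i → Dec (P i)) x → P x → (∀ i → P i → i ≡ x) →
               first P? ≡ just x
first-unique {suc m} P? x Px only with P? zero
first-unique {suc m} P? zero    Px only | yes _  = refl
first-unique {suc m} P? (suc x) Px only | yes P0 with only zero P0
... | ()
first-unique {suc m} P? zero    Px only | no ¬P0 = ⊥-elim (¬P0 Px)
first-unique {suc m} P? (suc x) Px only | no _ =
  cong (Maybe.map suc) (first-unique (P? ∘ suc) x Px (λ i Pi → Finₚ.suc-injective (only (suc i) Pi)))

first-cong : ∀ {m} {P Q : Fin m → Set} (P? : ∀ i → Dec (P i)) (Q? : ∀ i → Dec (Q i)) →
             (∀ i → P i → Q i) → (∀ i → Q i → P i) → first P? ≡ first Q?
first-cong {zero}  P? Q? to from = refl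
first-cong {suc m} P? Q? to from with P? zero | Q? zero
... | yes _  | yes _  = refl
... | no _   | no _   = cong (Maybe.map suc) (first-cong (P? ∘ suc) (Q? ∘ suc) (to ∘ suc) (from ∘ suc))
... | yes P0 | no ¬Q0 = ⊥-elim (¬Q0 (to zero P0))
... | no ¬P0 | yes Q0 = ⊥-elim (¬P0 (from zero Q0))

∈-⇒≢ : ∀ {m} (p : Subset m) {x y} → x ∈ p - y → x ≢ y
∈-⇒≢ (_ ∷ p) {zero}  {zero}  () refl
∈-⇒≢ (_ ∷ p) {suc x} {suc y} (there x∈) refl = ∈-⇒≢ p x∈ refl

elems : ∀ {m} → List (Fin m) → Subset m
elems [] = ∅
elems (x ∷ xs) = ⁅ x ⁆ ∪ elems xs

∈elems⁺ : ∀ {m} {x : Fin m} {xs} → x ∈L xs → x ∈ elems xs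
∈elems⁺ {xs = y ∷ _} (hereL refl) = x∈p∪q⁺ (inj₁ (x∈⁅x⁆ y))
∈elems⁺ (thereL x∈xs) = x∈p∪q⁺ (inj₂ (∈elems⁺ x∈xs))

∈elems⁻ : ∀ {m} {x : Fin m} xs → x ∈ elems xs → x ∈L xs
∈elems⁻ [] x∈∅ = ⊥-elim (∉⊥ x∈∅)
∈elems⁻ (y ∷ xs) x∈ with x∈p∪q⁻ ⁅ y ⁆ (elems xs) x∈
... | inj₁ x∈⁅y⁆ = hereL (x∈⁅y⁆⇒x≡y y x∈⁅y⁆)
... | inj₂ x∈xs = thereL (∈elems⁻ xs x∈xs)

module GraphFacts (G : Graph) where
  open import Data.List.Membership.DecPropositional (Finₚ._≟_ {n = n G}) using () renaming (_∈?_ to _∈L?_)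

  V : Set
  V = Fin (n G)

  adj-sym : ∀ {u v} → Adj G u v → Adj G v u
  adj-sym {u} {v} a = trans (Graph.sym G v u) a

  adj⇒≢ : ∀ {u v} → Adj G u v → u ≢ v
  adj⇒≢ {u} a refl with trans (≡-sym a) (irrefl G u)
  ... | ()

  adj? : ∀ u v → Dec (Adj G u v)
  adj? u v = adj G u v ≟ᵇ true

  reach-start : ∀ {S u v} → Reach G S u v → u ∈ S
  reach-start (here u∈S) = u∈S
  reach-start (step r _ _) = reach-start r

  reach-end : ∀ {S u v} → Reach G S u v → v ∈ S
  reach-end (here v∈S) = v∈S
  reach-end (step _ _ v∈S) = v∈S

  reach-edge : ∀ {S u v} → u ∈ S → v ∈ S → Adj G u v → Reach G S u v
  reach-edge u∈S v∈S a = step (here u∈S) a v∈S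

  reach-trans : ∀ {S u v w} → Reach G S u v → Reach G S v w → Reach G S u w
  reach-trans r (here _) = r
  reach-trans r (step r' a w∈S) = step (reach-trans r r') a w∈S

  reach-sym : ∀ {S u v} → Reach G S u v → Reach G S v u
  reach-sym (here u∈S) = here u∈S
  reach-sym (step r a v∈S) = reach-trans (reach-edge v∈S (reach-end r) (adj-sym a)) (reach-sym r)

  reach-mono : ∀ {S T u v} → S ⊆ T → Reach G S u v → Reach G T u v
  reach-mono S⊆T (here u∈S) = here (S⊆T u∈S)
  reach-mono S⊆T (step r a v∈S) = step (reach-mono S⊆T r) a (S⊆T v∈S)

  hub-connected : ∀ T c → (∀ a → a ∈ T → Reach G T a c) → Connected G T
  hub-connected T c to-c u v u∈T v∈T = reach-trans (to-c u u∈T) (reach-sym (to-c v v∈T))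

  -- A walk from u either is trivial or leaves u along an edge and never returns
  -- (cut it at the last visit of u). This drives the decision procedure below.
  reach-first-step : ∀ {S u v} → Reach G S u v → u ≡ v ⊎ Σ V λ w → Adj G u w × Reach G (S - u) w v
  reach-first-step (here _) = inj₁ refl
  reach-first-step {S} {u} (step {w'} {v} r a v∈S) with v Finₚ.≟ u
  ... | yes refl = inj₁ refl
  ... | no v≢u with reach-first-step r
  ...   | inj₁ refl = inj₂ (v , a , here (x∈p∧x≢y⇒x∈p-y v∈S v≢u))
  ...   | inj₂ (w , a' , r') = inj₂ (w , a' , step r' a (x∈p∧x≢y⇒x∈p-y v∈S v≢u))

  reach? : ∀ S u v → Dec (Reach G S u v)
  reach? S = go S (⊂-wellFounded S)
    where
    go : ∀ S → Acc _⊂_ S → ∀ u v → Dec (Reach G S u v)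
    go S (acc smaller) u v with u ∈? S | u Finₚ.≟ v
    ... | no u∉S | _ = no (u∉S ∘ reach-start)
    ... | yes u∈S | yes refl = yes (here u∈S)
    ... | yes u∈S | no u≢v =
      map′ leave (λ r → first-step (reach-first-step r))
           (Finₚ.any? λ w → adj? u w ×-dec go (S - u) (smaller (x∈p⇒p-x⊂p u∈S)) w v)
      where
      Leaving = Σ V λ w → Adj G u w × Reach G (S - u) w v
      leave : Leaving → Reach G S u v
      leave (w , a , r) = reach-trans (reach-edge u∈S (p─q⊆p S _ (reach-start r)) a) (reach-mono (p─q⊆p S _) r)
      first-step : u ≡ v ⊎ Leaving → Leaving
      first-step (inj₁ u≡v) = ⊥-elim (u≢v u≡v)
      first-step (inj₂ r) = r

  connected? : ∀ S → Dec (Connected G S)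
  connected? S = Finₚ.all? λ u → Finₚ.all? λ v → (u ∈? S) →-dec ((v ∈? S) →-dec reach? S u v)

  nonseparable? : ∀ S → Dec (Nonseparable G S)
  nonseparable? S = nonempty? S ×-dec (connected? S ×-dec Finₚ.all? λ v → (v ∈? S) →-dec connected? (S - v))

  -- Every nonseparable set is contained in a block: enlarge it while possible
  -- (well-founded, since a finite set can only grow finitely often).
  block-above : ∀ C → Nonseparable G C → Σ (Subset (n G)) λ B → C ⊆ B × IsBlock G B
  block-above C ns = go C ns (⊃-wellFounded C)
    where
    _⊂?_ : ∀ (C D : Subset (n G)) → Dec (C ⊂ D)
    C ⊂? D = (C ⊆? D) ×-dec Finₚ.any? (λ x → (x ∈? D) ×-dec ¬? (x ∈? C))
    go : ∀ C → Nonseparable G C → Acc _⊃_ C → Σ (Subset (n G)) λ B → C ⊆ B × IsBlock G B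
    go C ns (acc larger) with anySubset? (λ D → (C ⊂? D) ×-dec nonseparable? D)
    ... | yes (D , C⊂D , nsD) with B , D⊆B , block ← go D nsD (larger C⊂D) = B , D⊆B ∘ proj₁ C⊂D , block
    ... | no no-larger = C , (λ x∈C → x∈C) , ns , maximal
      where
      maximal : ∀ D → C ⊆ D → Nonseparable G D → D ⊆ C
      maximal D C⊆D nsD {x} x∈D with x ∈? C
      ... | yes x∈C = x∈C
      ... | no x∉C = ⊥-elim (no-larger (D , (C⊆D , x , x∈D , x∉C) , nsD))

  clique-connected : ∀ T → IsClique G T → Connected G T
  clique-connected T clique u v u∈T v∈T with u Finₚ.≟ v
  ... | yes refl = here u∈T
  ... | no u≢v = reach-edge u∈T v∈T (clique u v u∈T v∈T u≢v)

  clique-nonseparable : ∀ T x → x ∈ T → IsClique G T → Nonseparable G T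
  clique-nonseparable T x x∈T clique = (x , x∈T) , clique-connected T clique ,
    λ z _ → clique-connected (T - z) λ u v u∈ v∈ → clique u v (p─q⊆p T _ u∈) (p─q⊆p T _ v∈)

  clique-reach : ∀ {K} T → IsClique G K → ∀ {a c} → a ∈ K → c ∈ K → a ∈ T → c ∈ T → Reach G T a c
  clique-reach T clique {a} {c} a∈K c∈K a∈T c∈T with a Finₚ.≟ c
  ... | yes refl = here a∈T
  ... | no a≢c = reach-edge a∈T c∈T (clique a c a∈K c∈K a≢c)

  clique-union-nonseparable : ∀ B₁ B₂ u v → u ≢ v → u ∈ B₁ → v ∈ B₁ → u ∈ B₂ → v ∈ B₂ →
    IsClique G B₁ → IsClique G B₂ → Nonseparable G (B₁ ∪ B₂)
  clique-union-nonseparable B₁ B₂ u v u≢v u₁ v₁ u₂ v₂ c₁ c₂ =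
    (u , x∈p∪q⁺ (inj₁ u₁)) , hub-connected _ u (to-hub _ u₁ u₂ (x∈p∪q⁺ (inj₁ u₁)) (λ a∈ → a∈)) ,
    without
    where
    to-hub : ∀ T {c} → c ∈ B₁ → c ∈ B₂ → c ∈ T → T ⊆ B₁ ∪ B₂ → ∀ a → a ∈ T → Reach G T a c
    to-hub T c∈₁ c∈₂ c∈T T⊆ a a∈T with x∈p∪q⁻ B₁ B₂ (T⊆ a∈T)
    ... | inj₁ a∈₁ = clique-reach T c₁ a∈₁ c∈₁ a∈T c∈T
    ... | inj₂ a∈₂ = clique-reach T c₂ a∈₂ c∈₂ a∈T c∈T
    without : ∀ z → z ∈ B₁ ∪ B₂ → Connected G ((B₁ ∪ B₂) - z)
    without z _ with u Finₚ.≟ z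
    ... | no u≢z =
      hub-connected _ u (to-hub _ u₁ u₂ (x∈p∧x≢y⇒x∈p-y (x∈p∪q⁺ (inj₁ u₁)) u≢z) (p─q⊆p _ _))
    ... | yes refl =
      hub-connected _ v (to-hub _ v₁ v₂ (x∈p∧x≢y⇒x∈p-y (x∈p∪q⁺ (inj₁ v₁)) (u≢v ∘ ≡-sym)) (p─q⊆p _ _))

  edge-nonseparable : ∀ {u v} → Adj G u v → Nonseparable G (⁅ u ⁆ ∪ ⁅ v ⁆)
  edge-nonseparable {u} {v} a = clique-nonseparable _ u (x∈p∪q⁺ (inj₁ (x∈⁅x⁆ u))) edge-clique
    where
    endpoint : ∀ {x} → x ∈ ⁅ u ⁆ ∪ ⁅ v ⁆ → x ≡ u ⊎ x ≡ v
    endpoint x∈ with x∈p∪q⁻ ⁅ u ⁆ ⁅ v ⁆ x∈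
    ... | inj₁ x∈u = inj₁ (x∈⁅y⁆⇒x≡y u x∈u)
    ... | inj₂ x∈v = inj₂ (x∈⁅y⁆⇒x≡y v x∈v)
    edge-clique : IsClique G (⁅ u ⁆ ∪ ⁅ v ⁆)
    edge-clique x y x∈ y∈ x≢y with endpoint x∈ | endpoint y∈
    ... | inj₁ refl | inj₁ refl = ⊥-elim (x≢y refl)
    ... | inj₁ refl | inj₂ refl = a
    ... | inj₂ refl | inj₁ refl = adj-sym a
    ... | inj₂ refl | inj₂ refl = ⊥-elim (x≢y refl)

  edge-block : ∀ u v → Adj G u v → Σ (Subset (n G)) λ B → IsBlock G B × u ∈ B × v ∈ B
  edge-block u v a with B , uv⊆B , block ← block-above (⁅ u ⁆ ∪ ⁅ v ⁆) (edge-nonseparable a) =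
    B , block , uv⊆B (x∈p∪q⁺ (inj₁ (x∈⁅x⁆ u))) , uv⊆B (x∈p∪q⁺ (inj₂ (x∈⁅x⁆ v)))

  Walk : V → List V → V → Set
  Walk x [] y = Adj G x y
  Walk x (p ∷ ps) y = Adj G x p × Walk p ps y

  walk-split : ∀ x ps z qs y → Walk x (ps ++ z ∷ qs) y → Walk x ps z × Walk z qs y
  walk-split x [] z qs y (a , w) = a , w
  walk-split x (p ∷ ps) z qs y (a , w) with w₁ , w₂ ← walk-split p ps z qs y w = (a , w₁) , w₂

  walk-join : ∀ x ps z qs y → Walk x ps z → Walk z qs y → Walk x (ps ++ z ∷ qs) y
  walk-join x [] z qs y a w = a , w
  walk-join x (p ∷ ps) z qs y (a , w₁) w₂ = a , walk-join p ps z qs y w₁ w₂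

  walk-reverse : ∀ x ps y → Walk x ps y → Walk y (reverse ps) x
  walk-reverse x [] y a = adj-sym a
  walk-reverse x (p ∷ ps) y (a , w) = subst (λ l → Walk y l x) (≡-sym (unfold-reverse p ps))
    (walk-join y (reverse ps) p [] x (walk-reverse p ps y w) (adj-sym a))

  cut-loop : ∀ p rs y → Unique rs → Walk p rs y → p ∈L rs →
             Σ (List V) λ post → Unique (p ∷ post) × Walk p post y × post ⊆L rs
  cut-loop p rs y uniq w p∈ with pre , post , refl ← ∈-∃++ p∈ =
    post , unique-drop pre uniq , proj₂ (walk-split p pre p post y w) , xs⊆ys++xs (p ∷ post) pre ∘ thereL

  -- Every walk contains a path: recursively shorten the tail, then cut a loop at the
  -- head if there is one. The path keeps the first inner vertex p.
  to-path : ∀ x p ps y → Walk x (p ∷ ps) y →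
            Σ (List V) λ qs → Unique (p ∷ qs) × Walk x (p ∷ qs) y × qs ⊆L ps
  to-path x p [] y w = [] , [] ∷ [] , w , λ ()
  to-path x p (p' ∷ ps) y (a , w) with qs , uniq , w' , qs⊆ps ← to-path p p' ps y w | p ∈L? (p' ∷ qs)
  ... | no p∉ = p' ∷ qs , ¬Any⇒All¬ _ p∉ ∷ uniq , (a , w') , ∷⁺ʳ p' qs⊆ps
  ... | yes p∈ with post , uniq' , w'' , post⊆ ← cut-loop p (p' ∷ qs) y uniq w' p∈ =
    post , uniq' , (a , w'') , ⊆-trans post⊆ (∷⁺ʳ p' qs⊆ps)

  walk-from : ∀ {T} x ps y → Walk x ps y → x ∈ T → (∀ {p} → p ∈L ps → p ∈ T) →
              ∀ {p} → p ∈L ps → Reach G T x p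
  walk-from x (q ∷ qs) y (a , w) x∈T ps⊆T (hereL refl) = reach-edge x∈T (ps⊆T (hereL refl)) a
  walk-from x (q ∷ qs) y (a , w) x∈T ps⊆T (thereL p∈) =
    reach-trans (reach-edge x∈T (ps⊆T (hereL refl)) a) (walk-from q qs y w (ps⊆T (hereL refl)) (ps⊆T ∘ thereL) p∈)

  walk-reach : ∀ {T} x ps y → Walk x ps y → x ∈ T → (∀ {p} → p ∈L ps → p ∈ T) → y ∈ T → Reach G T x y
  walk-reach x [] y a x∈T _ y∈T = reach-edge x∈T y∈T a
  walk-reach x (q ∷ qs) y (a , w) x∈T ps⊆T y∈T =
    reach-trans (reach-edge x∈T (ps⊆T (hereL refl)) a) (walk-reach q qs y w (ps⊆T (hereL refl)) (ps⊆T ∘ thereL) y∈T)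

  walk-to : ∀ {T} x ps y → Walk x ps y → (∀ {p} → p ∈L ps → p ∈ T) → y ∈ T →
            ∀ {p} → p ∈L ps → Reach G T p y
  walk-to x (q ∷ qs) y (_ , w) ps⊆T y∈T (hereL refl) = walk-reach q qs y w (ps⊆T (hereL refl)) (ps⊆T ∘ thereL) y∈T
  walk-to x (q ∷ qs) y (_ , w) ps⊆T y∈T (thereL p∈) = walk-to q qs y w (ps⊆T ∘ thereL) y∈T p∈

  -- A path between two distinct vertices x, y of a clique K whose inner vertices avoid K
  -- closes a cycle through K: K together with the path is nonseparable.
  detour-nonseparable : ∀ K x ps y → IsClique G K → x ∈ K → y ∈ K → x ≢ y →
    Unique ps → Walk x ps y → (∀ {p} → p ∈L ps → p ∉ K) → Nonseparable G (K ∪ elems ps)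
  detour-nonseparable K x ps y clique x∈K y∈K x≢y uniq w outside =
    (x , K⊆C x∈K) , hub-connected C x (to-x C (K⊆C x∈K) (λ a∈ → a∈) (λ p∈ → ps⊆C p∈)) , remove
    where
    C = K ∪ elems ps
    K⊆C : K ⊆ C
    K⊆C = p⊆p∪q (elems ps)
    ps⊆C : ∀ {p} → p ∈L ps → p ∈ C
    ps⊆C p∈ = x∈p∪q⁺ (inj₂ (∈elems⁺ p∈))
    C-cases : ∀ {a} → a ∈ C → a ∈ K ⊎ a ∈L ps
    C-cases a∈ with x∈p∪q⁻ K (elems ps) a∈
    ... | inj₁ a∈K = inj₁ a∈K
    ... | inj₂ a∈ps = inj₂ (∈elems⁻ ps a∈ps)
    to-x : ∀ T → x ∈ T → T ⊆ C → (∀ {p} → p ∈L ps → p ∈ T) → ∀ a → a ∈ T → Reach G T a x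
    to-x T x∈T T⊆C ps⊆T a a∈T with C-cases (T⊆C a∈T)
    ... | inj₁ a∈K = clique-reach T clique a∈K x∈K a∈T x∈T
    ... | inj₂ a∈ps = reach-sym (walk-from x ps y w x∈T ps⊆T a∈ps)
    to-y : ∀ T → y ∈ T → T ⊆ C → (∀ {p} → p ∈L ps → p ∈ T) → ∀ a → a ∈ T → Reach G T a y
    to-y T y∈T T⊆C ps⊆T a a∈T with C-cases (T⊆C a∈T)
    ... | inj₁ a∈K = clique-reach T clique a∈K y∈K a∈T y∈T
    ... | inj₂ a∈ps = walk-to x ps y w ps⊆T y∈T a∈ps
    survives : ∀ {z a} → a ∈ C → a ≢ z → a ∈ C - z
    survives = x∈p∧x≢y⇒x∈p-y
    -- removing a vertex of K: the path survives, and x or y survives as a hub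
    path-survives : ∀ {z} → z ∈ K → ∀ {p} → p ∈L ps → p ∈ C - z
    path-survives z∈K p∈ = survives (ps⊆C p∈) λ { refl → outside p∈ z∈K }
    remove-from-K : ∀ z → z ∈ K → Connected G (C - z)
    remove-from-K z z∈K with x Finₚ.≟ z
    ... | no x≢z = hub-connected _ x (to-x _ (survives (K⊆C x∈K) x≢z) (p─q⊆p C _) (path-survives z∈K))
    ... | yes refl =
      hub-connected _ y (to-y _ (survives (K⊆C y∈K) (x≢y ∘ ≡-sym)) (p─q⊆p C _) (path-survives z∈K))
    -- removing an inner vertex z splits the path into a part ending at x and a part
    -- ending at y, and x, y are adjacent
    remove-from-path : ∀ {z} pre post → ps ≡ pre ++ z ∷ post → Connected G (C - z)
    remove-from-path {z} pre post refl = hub-connected _ x to-x'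
      where
      z∉K : z ∉ K
      z∉K = outside (∈-++⁺ʳ pre (hereL refl))
      z-once = unique-split pre z post uniq
      w-pre,w-post = walk-split x pre z post y w
      x∈T = survives (K⊆C x∈K) λ { refl → z∉K x∈K }
      y∈T = survives (K⊆C y∈K) λ { refl → z∉K y∈K }
      to-x' : ∀ a → a ∈ C - z → Reach G (C - z) a x
      to-x' a a∈T with C-cases (p─q⊆p C _ a∈T)
      ... | inj₁ a∈K = clique-reach _ clique a∈K x∈K a∈T x∈T
      ... | inj₂ a∈ps with ∈-++⁻ pre a∈ps
      ...   | inj₁ a∈pre = reach-sym (walk-from x pre z (proj₁ w-pre,w-post) x∈T
                (λ p∈ → survives (ps⊆C (∈-++⁺ˡ p∈)) λ { refl → proj₁ z-once p∈ }) a∈pre)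
      ...   | inj₂ (hereL refl) = ⊥-elim (∈-⇒≢ C a∈T refl)
      ...   | inj₂ (thereL a∈post) = reach-trans
                (walk-to z post y (proj₂ w-pre,w-post)
                  (λ p∈ → survives (ps⊆C (∈-++⁺ʳ pre (thereL p∈))) λ { refl → proj₂ z-once p∈ })
                  y∈T a∈post)
                (reach-edge y∈T x∈T (clique y x y∈K x∈K (x≢y ∘ ≡-sym)))
    remove : ∀ z → z ∈ C → Connected G (C - z)
    remove z z∈C with C-cases z∈C
    ... | inj₁ z∈K = remove-from-K z z∈K
    ... | inj₂ z∈ps with pre , post , eq ← ∈-∃++ z∈ps = remove-from-path pre post eq

  Outside : Subset (n G) → V → Subset (n G)
  Outside B x = ∁ B ∪ ⁅ x ⁆

  outside⁻ : ∀ B x {v} → v ∈ Outside B x → v ∉ B ⊎ v ≡ x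
  outside⁻ B x v∈ with x∈p∪q⁻ (∁ B) ⁅ x ⁆ v∈
  ... | inj₁ v∈∁B = inj₁ (x∈∁p⇒x∉p v∈∁B)
  ... | inj₂ v∈x = inj₂ (x∈⁅y⁆⇒x≡y x v∈x)

  outside⁺ : ∀ B x {v} → v ∉ B → v ∈ Outside B x
  outside⁺ B x v∉B = x∈p∪q⁺ (inj₁ (x∉p⇒x∈∁p v∉B))

  outside-self : ∀ B x → x ∈ Outside B x
  outside-self B x = x∈p∪q⁺ (inj₂ (x∈⁅x⁆ x))

  leave-block : ∀ B x w → Reach G (Outside B x) x w →
    w ≡ x ⊎ Σ (List V) λ qs → Walk x qs w × (∀ {p} → p ∈L qs → p ∉ B) × w ∉ B
  leave-block B x w (here _) = inj₁ refl
  leave-block B x w (step {w'} r a w∈) with w Finₚ.≟ x | outside⁻ B x w∈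
  ... | yes w≡x | _ = inj₁ w≡x
  ... | no w≢x | inj₂ w≡x = ⊥-elim (w≢x w≡x)
  ... | no w≢x | inj₁ w∉B with leave-block B x w' r
  ...   | inj₁ refl = inj₂ ([] , a , (λ ()) , w∉B)
  ...   | inj₂ (qs , walk , out , w'∉B) = inj₂ (qs ++ w' ∷ [] , walk-join x qs w' [] w walk a , out' , w∉B)
    where
    out' : ∀ {p} → p ∈L qs ++ w' ∷ [] → p ∉ B
    out' p∈ with ∈-++⁻ qs p∈
    ... | inj₁ p∈qs = out p∈qs
    ... | inj₂ (hereL refl) = w'∉B

  HangsAt : Subset (n G) → V → V → Set
  HangsAt B w x = x ∈ B × Reach G (Outside B x) x w

  hangs-at? : ∀ B w x → Dec (HangsAt B w x)
  hangs-at? B w x = (x ∈? B) ×-dec reach? (Outside B x) x w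

module BlockStructure {G : Graph} (block-graph : IsBlockGraph G) where
  open GraphFacts G

  block-unique : ∀ B₁ B₂ {u v} → u ≢ v → IsBlock G B₁ → IsBlock G B₂ →
                 u ∈ B₁ → v ∈ B₁ → u ∈ B₂ → v ∈ B₂ → B₁ ≡ B₂
  block-unique B₁ B₂ u≢v b₁ b₂ u₁ v₁ u₂ v₂ = ⊆-antisym
    (λ x∈ → proj₂ b₂ (B₁ ∪ B₂) (q⊆p∪q B₁ B₂) union (p⊆p∪q B₂ x∈))
    (λ x∈ → proj₂ b₁ (B₁ ∪ B₂) (p⊆p∪q B₂) union (q⊆p∪q B₁ B₂ x∈))
    where
    union = clique-union-nonseparable B₁ B₂ _ _ u≢v u₁ v₁ u₂ v₂ (block-graph B₁ b₁) (block-graph B₂ b₂)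

  -- No detours around a block: two distinct vertices of a block B are never joined by
  -- a walk with a nonempty interior outside B, since a path inside that walk would
  -- enlarge B to a bigger nonseparable set.
  no-detour : ∀ B x ps y → IsBlock G B → x ∈ B → y ∈ B → x ≢ y →
              Walk x ps y → (∀ {p} → p ∈L ps → p ∉ B) → ∀ {z} → z ∈L ps → ⊥
  no-detour B x (p ∷ ps) y block x∈B y∈B x≢y w outside _
    with qs , uniq , w' , qs⊆ps ← to-path x p ps y w =
    outside (hereL refl) (proj₂ block (B ∪ elems (p ∷ qs)) (p⊆p∪q _) enlarged
                                (x∈p∪q⁺ (inj₂ (∈elems⁺ {xs = p ∷ qs} (hereL refl)))))
    where
    enlarged = detour-nonseparable B x (p ∷ qs) y (block-graph B block) x∈B y∈B x≢y uniq w'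
                 (outside ∘ ∷⁺ʳ p qs⊆ps)

  hangs-at-unique : ∀ B {x y w} → IsBlock G B → HangsAt B w x → HangsAt B w y → w ∉ B → x ≡ y
  hangs-at-unique B {x} {y} {w} block (x∈B , rx) (y∈B , ry) w∉B with x Finₚ.≟ y
  ... | yes x≡y = x≡y
  ... | no x≢y with leave-block B x w rx | leave-block B y w ry
  ...   | inj₁ refl | _ = ⊥-elim (w∉B x∈B)
  ...   | _ | inj₁ refl = ⊥-elim (w∉B y∈B)
  ...   | inj₂ (qs , wq , out-q , _) | inj₂ (rs , wr , out-r , _) =
    ⊥-elim (no-detour B x (qs ++ w ∷ reverse rs) y block x∈B y∈B x≢y
              (walk-join x qs w (reverse rs) y wq (walk-reverse y rs w wr)) out (∈-++⁺ʳ qs (hereL refl)))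
    where
    out : ∀ {p} → p ∈L qs ++ w ∷ reverse rs → p ∉ B
    out p∈ with ∈-++⁻ qs p∈
    ... | inj₁ p∈qs = out-q p∈qs
    ... | inj₂ (hereL refl) = w∉B
    ... | inj₂ (thereL p∈rs) = out-r (Anyₚ.reverse⁻ p∈rs)

  -- The vertex of B at which w hangs off B (nothing if w is not connected to B).
  attachment : Subset (n G) → V → Maybe V
  attachment B w = first (hangs-at? B w)

  attachment-in : ∀ B {x} → x ∈ B → attachment B x ≡ just x
  attachment-in B {x} x∈B = first-unique (hangs-at? B x) x (x∈B , here (outside-self B x)) only
    where
    only : ∀ i → HangsAt B x i → i ≡ x
    only i (_ , r) with outside⁻ B i (reach-end r)
    ... | inj₁ x∉B = ⊥-elim (x∉B x∈B)
    ... | inj₂ x≡i = ≡-sym x≡i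

  attachment-leave : ∀ B {u v} → IsBlock G B → u ∈ B → v ∉ B → Adj G u v → attachment B v ≡ just u
  attachment-leave B {u} {v} block u∈B v∉B a = first-unique (hangs-at? B v) u v-at-u
    λ i v-at-i → hangs-at-unique B block v-at-i v-at-u v∉B
    where
    v-at-u : HangsAt B v u
    v-at-u = u∈B , reach-edge (outside-self B u) (outside⁺ B u v∉B) a

  attachment-outside : ∀ B {u v} → u ∉ B → v ∉ B → Adj G u v → attachment B u ≡ attachment B v
  attachment-outside B {u} {v} u∉B v∉B a = first-cong (hangs-at? B u) (hangs-at? B v)
    (λ { i (i∈B , r) → i∈B , step r a (outside⁺ B i v∉B) })
    (λ { i (i∈B , r) → i∈B , step r (adj-sym a) (outside⁺ B i u∉B) })

  attachment-edge : ∀ B B₀ {u v} → IsBlock G B → IsBlock G B₀ → B ≢ B₀ →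
                    u ∈ B₀ → v ∈ B₀ → Adj G u v → attachment B u ≡ attachment B v
  attachment-edge B B₀ {u} {v} block block₀ B≢B₀ u∈B₀ v∈B₀ a with u ∈? B | v ∈? B
  ... | yes u∈B | yes v∈B =
    ⊥-elim (B≢B₀ (block-unique B B₀ (adj⇒≢ a) block block₀ u∈B v∈B u∈B₀ v∈B₀))
  ... | yes u∈B | no v∉B = trans (attachment-in B u∈B) (≡-sym (attachment-leave B block u∈B v∉B a))
  ... | no u∉B | yes v∈B = trans (attachment-leave B block v∈B u∉B (adj-sym a)) (≡-sym (attachment-in B v∈B))
  ... | no u∉B | no v∉B = attachment-outside B u∉B v∉B a

elt : ∀ {m} (B : Subset m) → Fin ∣ B ∣ → Fin m
elt (true ∷ B) zero = zero
elt (true ∷ B) (suc i) = suc (elt B i)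
elt (false ∷ B) i = suc (elt B i)

elt∈ : ∀ {m} (B : Subset m) i → elt B i ∈ B
elt∈ (true ∷ B) zero = here
elt∈ (true ∷ B) (suc i) = there (elt∈ B i)
elt∈ (false ∷ B) i = there (elt∈ B i)

idx : ∀ {m} (B : Subset m) {x} → x ∈ B → Fin ∣ B ∣
idx (true ∷ B) here = zero
idx (true ∷ B) (there x∈) = suc (idx B x∈)
idx (false ∷ B) (there x∈) = idx B x∈

elt-idx : ∀ {m} (B : Subset m) {x} (x∈ : x ∈ B) → elt B (idx B x∈) ≡ x
elt-idx (true ∷ B) here = refl
elt-idx (true ∷ B) (there x∈) = cong suc (elt-idx B x∈)
elt-idx (false ∷ B) (there x∈) = cong suc (elt-idx B x∈)

idx-≢ : ∀ {m} (B : Subset m) {x y} (x∈ : x ∈ B) (y∈ : y ∈ B) → x ≢ y → idx B x∈ ≢ idx B y∈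
idx-≢ B x∈ y∈ x≢y e = x≢y (trans (≡-sym (elt-idx B x∈)) (trans (cong (elt B) e) (elt-idx B y∈)))

elt-mono : ∀ {m} (B : Subset m) i j → toℕ i < toℕ j → toℕ (elt B i) < toℕ (elt B j)
elt-mono (true ∷ B) zero (suc j) _ = s≤s z≤n
elt-mono (true ∷ B) (suc i) (suc j) (s≤s i<j) = s≤s (elt-mono B i j i<j)
elt-mono (false ∷ B) i j i<j = s≤s (elt-mono B i j i<j)

elt-injective : ∀ {m} (B : Subset m) {i j} → elt B i ≡ elt B j → i ≡ j
elt-injective B {i} {j} e with <-cmp (toℕ i) (toℕ j)
... | tri< i<j _ _ = ⊥-elim (<-irrefl (cong toℕ e) (elt-mono B i j i<j))
... | tri≈ _ i≡j _ = Finₚ.toℕ-injective i≡j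
... | tri> _ _ j<i = ⊥-elim (<-irrefl (cong toℕ (≡-sym e)) (elt-mono B j i j<i))

idx-elt : ∀ {m} (B : Subset m) i (x∈ : elt B i ∈ B) → idx B x∈ ≡ i
idx-elt B i x∈ = elt-injective B (elt-idx B x∈)

idx-irrelevant : ∀ {m} (B : Subset m) {x} (p q : x ∈ B) → idx B p ≡ idx B q
idx-irrelevant B p q = elt-injective B (trans (elt-idx B p) (≡-sym (elt-idx B q)))

elt-mono⁻ : ∀ {m} (B : Subset m) i j → toℕ (elt B i) < toℕ (elt B j) → toℕ i < toℕ j
elt-mono⁻ B i j lt with <-cmp (toℕ i) (toℕ j)
... | tri< i<j _ _ = i<j
... | tri≈ _ i≡j _ rewrite Finₚ.toℕ-injective i≡j = ⊥-elim (<-irrefl refl lt)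
... | tri> _ _ j<i = ⊥-elim (<-asym lt (elt-mono B j i j<i))

T-injective : ∀ {a b} → (T a → T b) → (T b → T a) → a ≡ b
T-injective {false} {false} _ _ = refl
T-injective {false} {true}  _ b⇒a = ⊥-elim (b⇒a _)
T-injective {true}  {false} a⇒b _ = ⊥-elim (a⇒b _)
T-injective {true}  {true}  _ _ = refl

elt-<ᵇ : ∀ {m} (B : Subset m) i j → (toℕ i <ᵇ toℕ j) ≡ (toℕ (elt B i) <ᵇ toℕ (elt B j))
elt-<ᵇ B i j = T-injective (λ t → <⇒<ᵇ (elt-mono B i j (<ᵇ⇒< _ _ t)))
                           (λ t → <⇒<ᵇ (elt-mono⁻ B i j (<ᵇ⇒< _ _ t)))

χ : Bool → ℕ
χ true = 1
χ false = 0

χ-∧ : ∀ a b → χ (a ∧ b) ≡ χ a * χ b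
χ-∧ true true = refl
χ-∧ true false = refl
χ-∧ false b = refl

∑-subset : ∀ {m} (B : Subset m) (h : Fin m → ℕ) →
           (∑[ i < ∣ B ∣ ] h (elt B i)) ≡ (∑[ u < m ] (χ (lookup B u) * h u))
∑-subset [] h = refl
∑-subset (true ∷ B) h = cong₂ _+_ (≡-sym (+-identityʳ (h zero))) (∑-subset B (h ∘ suc))
∑-subset (false ∷ B) h = ∑-subset B (h ∘ suc)

complete-adj⇒≢ : ∀ m {i j : Fin m} → Adj (complete m) i j → i ≢ j
complete-adj⇒≢ (suc m) {zero}  {zero}  () refl
complete-adj⇒≢ (suc m) {suc i} {suc j} a refl = complete-adj⇒≢ m {i} {j} a refl

≢⇒complete-adj : ∀ m {i j : Fin m} → i ≢ j → Adj (complete m) i j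
≢⇒complete-adj (suc m) {zero}  {zero}  i≢j = ⊥-elim (i≢j refl)
≢⇒complete-adj (suc m) {zero}  {suc j} i≢j = refl
≢⇒complete-adj (suc m) {suc i} {zero}  i≢j = refl
≢⇒complete-adj (suc m) {suc i} {suc j} i≢j = ≢⇒complete-adj m (i≢j ∘ cong suc)

complete-edge-test : ∀ m (i j : Fin m) → (adj (complete m) i j ∧ (toℕ i <ᵇ toℕ j)) ≡ (toℕ i <ᵇ toℕ j)
complete-edge-test m i j = T-injective (λ t → proj₂ (Equivalence.to T-∧ t))
  λ t → Equivalence.from T-∧ (subst T (≡-sym (≢⇒complete-adj m (i<j⇒i≢j (<ᵇ⇒< _ _ t)))) _ , t)
  where
  i<j⇒i≢j : toℕ i < toℕ j → i ≢ j
  i<j⇒i≢j i<j refl = <-irrefl refl i<j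

IsPrimeRatio : AP → AP → ℕ → Set
IsPrimeRatio A B p = Prime p × (diff B ≡ p * diff A ⊎ diff A ≡ p * diff B)

-- Having a prime deterministic ratio is decidable: the prime is at most the larger difference.
prime-ratio? : (A B : AP) → Dec (PrimeRatio A B)
prime-ratio? A B with Finₚ.any? {n = suc (diff A + diff B)}
                      (λ i → prime? (toℕ i) ×-dec ((diff B ≟ toℕ i * diff A) ⊎-dec (diff A ≟ toℕ i * diff B)))
... | yes (i , q) = yes (toℕ i , q)
... | no none = no (none ∘ bounded)
  where
  bound : ∀ p → (diff B ≡ p * diff A ⊎ diff A ≡ p * diff B) → p < suc (diff A + diff B)
  bound p (inj₁ e) = s≤s (≤-trans (m≤m*n p (diff A) ⦃ >-nonZero (diff≥1 A) ⦄) (subst (_≤ diff A + diff B) e (m≤n+m _ _)))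
  bound p (inj₂ e) = s≤s (≤-trans (m≤m*n p (diff B) ⦃ >-nonZero (diff≥1 B) ⦄) (subst (_≤ diff A + diff B) e (m≤m+n _ _)))
  bounded : PrimeRatio A B → Σ (Fin (suc (diff A + diff B))) λ i → IsPrimeRatio A B (toℕ i)
  bounded (p , ratio) = fromℕ< (bound p (proj₂ ratio)) ,
                        subst (IsPrimeRatio A B) (≡-sym (Finₚ.toℕ-fromℕ< (bound p (proj₂ ratio)))) ratio

defect : AP → AP → ℕ
defect A B = if does (prime-ratio? A B) then 0 else 1

defects : ∀ {m} → (Fin m → AP) → List (Fin m × Fin m) → ℕ
defects g [] = 0
defects g ((u , v) ∷ es) = defect (g u) (g v) + defects g es

npcount⇒≡defects : ∀ {H : Graph} (F : ArithIASI H) es {k} → NPCount F es k → k ≡ defects (f F) es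
npcount⇒≡defects F [] nil = refl
npcount⇒≡defects F ((u , v) ∷ es) (prm pr rest) with prime-ratio? (f F u) (f F v)
... | yes _ = npcount⇒≡defects F es rest
... | no ¬pr = ⊥-elim (¬pr pr)
npcount⇒≡defects F ((u , v) ∷ es) (nprm ¬pr rest) with prime-ratio? (f F u) (f F v)
... | yes pr = ⊥-elim (¬pr pr)
... | no _ = cong suc (npcount⇒≡defects F es rest)

npcount-defects : ∀ {H : Graph} (F : ArithIASI H) es → NPCount F es (defects (f F) es)
npcount-defects F [] = nil
npcount-defects F ((u , v) ∷ es) with prime-ratio? (f F u) (f F v)
... | yes pr = prm pr (npcount-defects F es)
... | no ¬pr = nprm ¬pr (npcount-defects F es)

defects-++ : ∀ {m} (g : Fin m → AP) xs ys → defects g (xs ++ ys) ≡ defects g xs + defects g ys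
defects-++ g [] ys = refl
defects-++ g ((u , v) ∷ xs) ys =
  trans (cong (defect (g u) (g v) +_) (defects-++ g xs ys)) (≡-sym (+-assoc (defect (g u) (g v)) (defects g xs) _))

defects-concat : ∀ {m k} {X : Set} (g : Fin m → AP) (h : X → List (Fin m × Fin m)) (t : Fin k → X) →
                 defects g (concatMap h (tabulate t)) ≡ ∑[ i < k ] defects g (h (t i))
defects-concat {k = zero} g h t = refl
defects-concat {k = suc k} g h t =
  trans (defects-++ g (h (t zero)) _) (cong (defects g (h (t zero)) +_) (defects-concat g h (t ∘ suc)))

defects-edges : ∀ (H : Graph) (g : Fin (n H) → AP) → defects g (edges H) ≡
  ∑[ u < n H ] ∑[ v < n H ] (χ (adj H u v ∧ (toℕ u <ᵇ toℕ v)) * defect (g u) (g v))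
defects-edges H g = trans (defects-concat g row (λ u → u)) (sum-cong-≗ λ u →
  trans (defects-concat g (entry u) (λ v → v)) (sum-cong-≗ λ v → single (adj H u v ∧ (toℕ u <ᵇ toℕ v))))
  where
  entry : Fin (n H) → Fin (n H) → List (Fin (n H) × Fin (n H))
  entry u v = if adj H u v ∧ (toℕ u <ᵇ toℕ v) then (u , v) ∷ [] else []
  row : Fin (n H) → List (Fin (n H) × Fin (n H))
  row u = concatMap (entry u) (allFin (n H))
  single : ∀ {u v} b → defects g (if b then (u , v) ∷ [] else []) ≡ χ b * defect (g u) (g v)
  single true = refl
  single false = refl

defects-edge-cong : ∀ (H : Graph) (g₁ g₂ : Fin (n H) → AP) →
  (∀ u v → Adj H u v → defect (g₁ u) (g₁ v) ≡ defect (g₂ u) (g₂ v)) → defects g₁ (edges H) ≡ defects g₂ (edges H)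
defects-edge-cong H g₁ g₂ same = trans (defects-edges H g₁)
  (trans (sum-cong-≗ λ u → sum-cong-≗ λ v → term u v) (≡-sym (defects-edges H g₂)))
  where
  term : ∀ u v → χ (adj H u v ∧ (toℕ u <ᵇ toℕ v)) * defect (g₁ u) (g₁ v)
               ≡ χ (adj H u v ∧ (toℕ u <ᵇ toℕ v)) * defect (g₂ u) (g₂ v)
  term u v with adj H u v in a
  ... | false = refl
  ... | true = cong (χ (toℕ u <ᵇ toℕ v) *_) (same u v a)

defects-subset : ∀ {m} (B : Subset m) (g : Fin m → AP) →
  defects (g ∘ elt B) (edges (complete ∣ B ∣)) ≡
  ∑[ u < m ] ∑[ v < m ] (χ (lookup B u) * (χ (lookup B v) * (χ (toℕ u <ᵇ toℕ v) * defect (g u) (g v))))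
defects-subset {m} B g = begin
  defects (g ∘ elt B) (edges K)
    ≡⟨ defects-edges K (g ∘ elt B) ⟩
  ∑[ i < ∣ B ∣ ] ∑[ j < ∣ B ∣ ] (χ (adj K i j ∧ (toℕ i <ᵇ toℕ j)) * d (elt B i) (elt B j))
    ≡⟨ sum-cong-≗ (λ i → sum-cong-≗ λ j →
         cong (λ b → χ b * d (elt B i) (elt B j)) (trans (complete-edge-test _ i j) (elt-<ᵇ B i j))) ⟩
  ∑[ i < ∣ B ∣ ] ∑[ j < ∣ B ∣ ] (χ (toℕ (elt B i) <ᵇ toℕ (elt B j)) * d (elt B i) (elt B j))
    ≡⟨ sum-cong-≗ (λ i → ∑-subset B (λ v → χ (toℕ (elt B i) <ᵇ toℕ v) * d (elt B i) v)) ⟩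
  ∑[ i < ∣ B ∣ ] ∑[ v < m ] (χ (lookup B v) * (χ (toℕ (elt B i) <ᵇ toℕ v) * d (elt B i) v))
    ≡⟨ ∑-subset B (λ u → ∑[ v < m ] (χ (lookup B v) * (χ (toℕ u <ᵇ toℕ v) * d u v))) ⟩
  ∑[ u < m ] (χ (lookup B u) * ∑[ v < m ] (χ (lookup B v) * (χ (toℕ u <ᵇ toℕ v) * d u v)))
    ≡⟨ sum-cong-≗ (λ u → *-distribˡ-sum {m} (χ (lookup B u)) _) ⟩
  ∑[ u < m ] ∑[ v < m ] (χ (lookup B u) * (χ (lookup B v) * (χ (toℕ u <ᵇ toℕ v) * d u v)))
    ∎
  where
  open ≡-Reasoning
  K = complete ∣ B ∣
  d : Fin m → Fin m → ℕ
  d u v = defect (g u) (g v)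

defect-cong : ∀ {A B A' B'} → (PrimeRatio A B → PrimeRatio A' B') → (PrimeRatio A' B' → PrimeRatio A B) →
              defect A B ≡ defect A' B'
defect-cong {A} {B} {A'} {B'} to from with prime-ratio? A B | prime-ratio? A' B'
... | yes _ | yes _ = refl
... | no _ | no _ = refl
... | yes pr | no ¬pr' = ⊥-elim (¬pr' (to pr))
... | no ¬pr | yes pr' = ⊥-elim (¬pr (from pr'))

scale-quotient : ∀ c a b k {x y} → x ≡ c * a → y ≡ c * b → b ≡ k * a → y ≡ k * x
scale-quotient c a b k refl refl refl = x*[y*z]≡y*[x*z] c k a

unscale-quotient : ∀ {c} a b k {x y} → 1 ≤ c → x ≡ c * a → y ≡ c * b → y ≡ k * x → b ≡ k * a
unscale-quotient {c} a b k c≥1 refl refl e =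
  *-cancelˡ-≡ b (k * a) c ⦃ >-nonZero c≥1 ⦄ (trans e (x*[y*z]≡y*[x*z] k c a))

defect-scale : ∀ {c} {A B A' B' : AP} → 1 ≤ c → diff A' ≡ c * diff A → diff B' ≡ c * diff B →
               defect A' B' ≡ defect A B
defect-scale {c} {A} {B} {A'} {B'} c≥1 a' b' = defect-cong down up
  where
  down : PrimeRatio A' B' → PrimeRatio A B
  down (p , p-prime , inj₁ e) = p , p-prime , inj₁ (unscale-quotient _ _ p c≥1 a' b' e)
  down (p , p-prime , inj₂ e) = p , p-prime , inj₂ (unscale-quotient _ _ p c≥1 b' a' e)
  up : PrimeRatio A B → PrimeRatio A' B'
  up (p , p-prime , inj₁ e) = p , p-prime , inj₁ (scale-quotient c _ _ p a' b' e)
  up (p , p-prime , inj₂ e) = p , p-prime , inj₂ (scale-quotient c _ _ p b' a' e)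

∑ˡ : ∀ {X : Set} → List X → (X → ℕ) → ℕ
∑ˡ [] h = 0
∑ˡ (x ∷ xs) h = h x + ∑ˡ xs h

∏ˡ : ∀ {X : Set} → List X → (X → ℕ) → ℕ
∏ˡ [] h = 1
∏ˡ (x ∷ xs) h = h x * ∏ˡ xs h

∑ˡ-cong : ∀ {X : Set} xs {h₁ h₂ : X → ℕ} → (∀ {x} → x ∈L xs → h₁ x ≡ h₂ x) →
          ∑ˡ xs h₁ ≡ ∑ˡ xs h₂
∑ˡ-cong [] _ = refl
∑ˡ-cong (x ∷ xs) e = cong₂ _+_ (e (hereL refl)) (∑ˡ-cong xs (e ∘ thereL))

∑ˡ-map : ∀ {X Y : Set} (g : X → Y) xs (h : Y → ℕ) → ∑ˡ (map g xs) h ≡ ∑ˡ xs (h ∘ g)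
∑ˡ-map g [] h = refl
∑ˡ-map g (x ∷ xs) h = cong (h (g x) +_) (∑ˡ-map g xs h)

∑ˡ-*ʳ : ∀ {X : Set} xs (h : X → ℕ) k → ∑ˡ xs (λ x → h x * k) ≡ ∑ˡ xs h * k
∑ˡ-*ʳ [] h k = refl
∑ˡ-*ʳ (x ∷ xs) h k = trans (cong (h x * k +_) (∑ˡ-*ʳ xs h k)) (≡-sym (*-distribʳ-+ k (h x) _))

∑ˡ-∑-comm : ∀ {X : Set} (xs : List X) m (h : X → Fin m → ℕ) →
            ∑ˡ xs (λ x → ∑[ i < m ] h x i) ≡ ∑[ i < m ] ∑ˡ xs (λ x → h x i)
∑ˡ-∑-comm [] m h = ≡-sym (∑-zero m)
  where
  ∑-zero : ∀ m → ∑[ i < m ] 0 ≡ 0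
  ∑-zero zero = refl
  ∑-zero (suc m) = ∑-zero m
∑ˡ-∑-comm (x ∷ xs) m h = trans (cong (∑[ i < m ] h x i +_) (∑ˡ-∑-comm xs m h)) (≡-sym (∑-distrib-+ (h x) _))

∑-term : ∀ m (h : Fin m → ℕ) j → h j ≤ ∑[ i < m ] h i
∑-term (suc m) h zero = m≤m+n _ _
∑-term (suc m) h (suc j) = ≤-trans (∑-term m (h ∘ suc) j) (m≤n+m _ _)

∑ˡ-χ-zero : ∀ {X : Set} xs (P : X → Bool) → (∀ {x} → x ∈L xs → P x ≡ false) → ∑ˡ xs (χ ∘ P) ≡ 0
∑ˡ-χ-zero [] P none = refl
∑ˡ-χ-zero (x ∷ xs) P none rewrite none (hereL refl) = ∑ˡ-χ-zero xs P (none ∘ thereL)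

∑ˡ-χ-one : ∀ {X : Set} xs → Unique xs → (P : X → Bool) {x₀ : X} → x₀ ∈L xs → P x₀ ≡ true →
           (∀ {x} → x ∈L xs → P x ≡ true → x ≡ x₀) → ∑ˡ xs (χ ∘ P) ≡ 1
∑ˡ-χ-one (x ∷ xs) (x∉ ∷ _) P (hereL refl) Px only rewrite Px = cong suc (∑ˡ-χ-zero xs P not-later)
  where
  not-later : ∀ {y} → y ∈L xs → P y ≡ false
  not-later {y} y∈ with P y in Py
  ... | false = refl
  ... | true = ⊥-elim (lookupᴬ x∉ y∈ (≡-sym (only (thereL y∈) Py)))
∑ˡ-χ-one (x ∷ xs) (x∉ ∷ uniq) P (thereL x₀∈) Px₀ only with P x in Px
... | true = ⊥-elim (lookupᴬ x∉ x₀∈ (only (hereL refl) Px))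
... | false = ∑ˡ-χ-one xs uniq P x₀∈ Px₀ (only ∘ thereL)

∏ˡ-cong : ∀ {X : Set} xs {h₁ h₂ : X → ℕ} → (∀ {x} → x ∈L xs → h₁ x ≡ h₂ x) →
          ∏ˡ xs h₁ ≡ ∏ˡ xs h₂
∏ˡ-cong [] _ = refl
∏ˡ-cong (x ∷ xs) e = cong₂ _*_ (e (hereL refl)) (∏ˡ-cong xs (e ∘ thereL))

∏ˡ-positive : ∀ {X : Set} xs (h : X → ℕ) → (∀ x → 1 ≤ h x) → 1 ≤ ∏ˡ xs h
∏ˡ-positive [] h pos = s≤s z≤n
∏ˡ-positive (x ∷ xs) h pos = *-mono-≤ (pos x) (∏ˡ-positive xs h pos)

∏ˡ-cofactor : ∀ {X Y : Set} (key : X → Y) xs {x₀} (h₁ h₂ : X → ℕ) → Unique (map key xs) → x₀ ∈L xs →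
  (∀ {x} → x ∈L xs → key x ≢ key x₀ → h₁ x ≡ h₂ x) → (∀ x → 1 ≤ h₁ x) →
  Σ ℕ λ c → 1 ≤ c × ∏ˡ xs h₁ ≡ c * h₁ x₀ × ∏ˡ xs h₂ ≡ c * h₂ x₀
∏ˡ-cofactor key (x ∷ xs) h₁ h₂ (x-new ∷ _) (hereL refl) agree pos =
  ∏ˡ xs h₁ , ∏ˡ-positive xs h₁ pos , *-comm (h₁ x) _ ,
  trans (*-comm (h₂ x) _) (cong (_* h₂ x) (≡-sym (∏ˡ-cong xs λ x'∈ → agree (thereL x'∈) (other x'∈))))
  where
  other : ∀ {x'} → x' ∈L xs → key x' ≢ key x
  other x'∈ = ≢-sym (lookupᴬ x-new (∈-map⁺ key x'∈))
∏ˡ-cofactor key (x ∷ xs) h₁ h₂ (x-new ∷ keys-unique) (thereL x₀∈) agree pos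
  with c , c≥1 , p₁ , p₂ ← ∏ˡ-cofactor key xs h₁ h₂ keys-unique x₀∈ (agree ∘ thereL) pos =
  h₁ x * c , *-mono-≤ (pos x) c≥1 ,
  trans (cong (h₁ x *_) p₁) (≡-sym (*-assoc (h₁ x) c _)) ,
  trans (cong₂ _*_ (≡-sym (agree (hereL refl) x≢x₀)) p₂) (≡-sym (*-assoc (h₁ x) c _))
  where
  x≢x₀ : key x ≢ key _
  x≢x₀ = lookupᴬ x-new (∈-map⁺ key x₀∈)

∧-true : ∀ {a b} → a ∧ b ≡ true → a ≡ true × b ≡ true
∧-true {true} b≡true = refl , b≡true

module BlockDecomposition {G : Graph} (block-graph : IsBlockGraph G)
                          (Bs : List (Subset (n G))) (blocks : IsBlockList G Bs) where
  open GraphFacts G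
  open BlockStructure block-graph

  listed⇒block : ∀ {B} → B ∈L Bs → IsBlock G B
  listed⇒block = proj₁ blocks _

  DispensingK : Subset (n G) → ℕ → Set
  DispensingK B d = IsDispensingNumber (complete ∣ B ∣) d

  blocks-containing : ∀ u v → u ≢ v → ∑ˡ Bs (λ B → χ (lookup B u ∧ lookup B v)) ≡ χ (adj G u v)
  blocks-containing u v u≢v with adj G u v in uv
  ... | true with B₀ , block₀ , u∈B₀ , v∈B₀ ← edge-block u v uv =
    ∑ˡ-χ-one Bs (proj₂ (proj₂ blocks)) (λ B → lookup B u ∧ lookup B v) (proj₁ (proj₂ blocks) B₀ block₀)
             (cong₂ _∧_ ([]=⇒lookup u∈B₀) ([]=⇒lookup v∈B₀)) only
    where
    only : ∀ {B} → B ∈L Bs → (lookup B u ∧ lookup B v) ≡ true → B ≡ B₀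
    only {B} B∈ both with u∈ , v∈ ← ∧-true both =
      block-unique B B₀ u≢v (listed⇒block B∈) block₀ (lookup⇒[]= u B u∈) (lookup⇒[]= v B v∈) u∈B₀ v∈B₀
  ... | false = ∑ˡ-χ-zero Bs (λ B → lookup B u ∧ lookup B v) none
    where
    none : ∀ {B} → B ∈L Bs → (lookup B u ∧ lookup B v) ≡ false
    none {B} B∈ with lookup B u in u∈ | lookup B v in v∈
    ... | false | _ = refl
    ... | true | false = refl
    ... | true | true with () ← trans (≡-sym uv)
          (block-graph B (listed⇒block B∈) u v (lookup⇒[]= u B u∈) (lookup⇒[]= v B v∈) u≢v)

  pair-decompose : ∀ (g : V → AP) u v → χ (adj G u v ∧ (toℕ u <ᵇ toℕ v)) * defect (g u) (g v) ≡
    ∑ˡ Bs (λ B → χ (lookup B u) * (χ (lookup B v) * (χ (toℕ u <ᵇ toℕ v) * defect (g u) (g v))))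
  pair-decompose g u v = ≡-sym (begin
    ∑ˡ Bs (λ B → χ (lookup B u) * (χ (lookup B v) * c))
      ≡⟨ ∑ˡ-cong Bs (λ {B} _ → trans (≡-sym (*-assoc (χ (lookup B u)) _ c))
                                      (cong (_* c) (≡-sym (χ-∧ (lookup B u) _)))) ⟩
    ∑ˡ Bs (λ B → χ (lookup B u ∧ lookup B v) * c)
      ≡⟨ ∑ˡ-*ʳ Bs (λ B → χ (lookup B u ∧ lookup B v)) c ⟩
    ∑ˡ Bs (λ B → χ (lookup B u ∧ lookup B v)) * c
      ≡⟨ by-order (toℕ u <ᵇ toℕ v) refl ⟩
    χ (adj G u v ∧ (toℕ u <ᵇ toℕ v)) * d ∎)
    where
    open ≡-Reasoning
    d = defect (g u) (g v)
    c = χ (toℕ u <ᵇ toℕ v) * d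
    by-order : ∀ b → b ≡ (toℕ u <ᵇ toℕ v) →
               ∑ˡ Bs (λ B → χ (lookup B u ∧ lookup B v)) * (χ b * d) ≡ χ (adj G u v ∧ b) * d
    by-order false _ = trans (*-zeroʳ (∑ˡ Bs (λ B → χ (lookup B u ∧ lookup B v))))
                              (cong (λ q → χ q * d) (≡-sym (∧-zeroʳ (adj G u v))))
    by-order true u<v = cong₂ _*_ (trans (blocks-containing u v u≢v) (cong χ (≡-sym (∧-identityʳ _))))
                                   (+-identityʳ d)
      where
      u≢v : u ≢ v
      u≢v refl = <-irrefl refl (<ᵇ⇒< (toℕ u) (toℕ u) (subst T u<v _))

  defects-decompose : ∀ (g : V → AP) →
    defects g (edges G) ≡ ∑ˡ Bs (λ B → defects (g ∘ elt B) (edges (complete ∣ B ∣)))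
  defects-decompose g = begin
    defects g (edges G)
      ≡⟨ defects-edges G g ⟩
    ∑[ u < n G ] ∑[ v < n G ] (χ (adj G u v ∧ (toℕ u <ᵇ toℕ v)) * defect (g u) (g v))
      ≡⟨ sum-cong-≗ (λ u → trans (sum-cong-≗ (pair-decompose g u)) (≡-sym (∑ˡ-∑-comm Bs (n G) _))) ⟩
    ∑[ u < n G ] ∑ˡ Bs (λ B → ∑[ v < n G ] term B u v)
      ≡⟨ ≡-sym (∑ˡ-∑-comm Bs (n G) _) ⟩
    ∑ˡ Bs (λ B → ∑[ u < n G ] ∑[ v < n G ] term B u v)
      ≡⟨ ∑ˡ-cong Bs (λ {B} _ → ≡-sym (defects-subset B g)) ⟩
    ∑ˡ Bs (λ B → defects (g ∘ elt B) (edges (complete ∣ B ∣))) ∎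
    where
    open ≡-Reasoning
    term : Subset (n G) → V → V → ℕ
    term B u v = χ (lookup B u) * (χ (lookup B v) * (χ (toℕ u <ᵇ toℕ v) * defect (g u) (g v)))

  -- Restricting an arithmetic IASI of G to a block B gives one of the complete graph on B,
  -- since B is a clique of G.
  restrict : ArithIASI G → ∀ B → IsBlock G B → ArithIASI (complete ∣ B ∣)
  restrict F B block = record
    { f = f F ∘ elt B
    ; vinj = λ i j i≢j → vinj F (elt B i) (elt B j) (i≢j ∘ elt-injective B)
    ; edgeAP = λ i j a → edgeAP F (elt B i) (elt B j) (adj-of a)
    ; einj = λ i j i' j' a a' different → einj F _ _ _ _ (adj-of a) (adj-of a') (different ∘ reindex)
    }
    where
    adj-of : ∀ {i j} → Adj (complete ∣ B ∣) i j → Adj G (elt B i) (elt B j)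
    adj-of {i} {j} a = block-graph B block (elt B i) (elt B j) (elt∈ B i) (elt∈ B j)
                         (complete-adj⇒≢ _ a ∘ elt-injective B)
    reindex : ∀ {i j i' j'} → (elt B i ≡ elt B i' × elt B j ≡ elt B j') ⊎ (elt B i ≡ elt B j' × elt B j ≡ elt B i') →
              (i ≡ i' × j ≡ j') ⊎ (i ≡ j' × j ≡ i')
    reindex (inj₁ (e₁ , e₂)) = inj₁ (elt-injective B e₁ , elt-injective B e₂)
    reindex (inj₂ (e₁ , e₂)) = inj₂ (elt-injective B e₁ , elt-injective B e₂)

  -- Every arithmetic IASI of G has at least the sum of the blocks' dispensing numbers
  -- of non-prime edges, as its restriction to each block has at least ϑ(K_B).
  lower-bound : ∀ ds → Pointwise DispensingK Bs ds →
                (F : ArithIASI G) (j : ℕ) → NPCount F (edges G) j → sum ds ≤ j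
  lower-bound ds ϑs F j count = subst (sum ds ≤_)
    (≡-sym (trans (npcount⇒≡defects F (edges G) count) (defects-decompose (f F)))) (per-block Bs ds (proj₁ blocks) ϑs)
    where
    per-block : ∀ Bs' ds → (∀ B → B ∈L Bs' → IsBlock G B) → Pointwise DispensingK Bs' ds →
                sum ds ≤ ∑ˡ Bs' (λ B → defects (f F ∘ elt B) (edges (complete ∣ B ∣)))
    per-block [] [] _ [] = z≤n
    per-block (B ∷ Bs') (d ∷ ds) listed ((_ , minimal) ∷ ϑs) =
      +-mono-≤ (minimal (restrict F B block) _ (npcount-defects (restrict F B block) _))
               (per-block Bs' ds (λ B' → listed B' ∘ thereL) ϑs)
      where block = listed B (hereL refl)

  record BlockLabelling : Set where
    field
      B : Subset (n G)
      F : ArithIASI (complete ∣ B ∣)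
      d : ℕ
      d≡ : d ≡ defects (f F) (edges (complete ∣ B ∣))
  open BlockLabelling

  optimal-labellings : ∀ {Bs'} ds → Pointwise DispensingK Bs' ds →
    Σ (List BlockLabelling) λ ls → map B ls ≡ Bs' × ∑ˡ ls d ≡ sum ds
  optimal-labellings [] [] = [] , refl , refl
  optimal-labellings {B ∷ _} (d ∷ ds) (((F , count) , _) ∷ ϑs)
    with ls , Bs≡ , ∑≡ ← optimal-labellings ds ϑs =
    record { B = B ; F = F ; d = d ; d≡ = npcount⇒≡defects F _ count } ∷ ls , cong (B ∷_) Bs≡ , cong (d +_) ∑≡

  module Gluing (ls : List BlockLabelling) (Bs≡ : map B ls ≡ Bs) where

    diff-in : (ℓ : BlockLabelling) → ∀ {x} → x ∈ B ℓ → ℕ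
    diff-in ℓ x∈ = diff (f (F ℓ) (idx (B ℓ) x∈))

    diff-in-irrelevant : ∀ ℓ {x} (p q : x ∈ B ℓ) → diff-in ℓ p ≡ diff-in ℓ q
    diff-in-irrelevant ℓ p q = cong (λ i → diff (f (F ℓ) i)) (idx-irrelevant (B ℓ) p q)

    -- The same, extended by 1 to vertices outside the block and to an absent attachment.
    diff-at : BlockLabelling → Maybe V → ℕ
    diff-at ℓ nothing = 1
    diff-at ℓ (just x) with x ∈? B ℓ
    ... | yes x∈ = diff-in ℓ x∈
    ... | no _ = 1

    diff-at-positive : ∀ ℓ mx → 1 ≤ diff-at ℓ mx
    diff-at-positive ℓ nothing = s≤s z≤n
    diff-at-positive ℓ (just x) with x ∈? B ℓ
    ... | yes x∈ = diff≥1 (f (F ℓ) (idx (B ℓ) x∈))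
    ... | no _ = s≤s z≤n

    diff-at-∈ : ∀ ℓ {x} (x∈ : x ∈ B ℓ) → diff-at ℓ (just x) ≡ diff-in ℓ x∈
    diff-at-∈ ℓ {x} x∈ with x ∈? B ℓ
    ... | yes x∈' = diff-in-irrelevant ℓ x∈' x∈
    ... | no x∉ = ⊥-elim (x∉ x∈)

    factor : V → BlockLabelling → ℕ
    factor w ℓ = diff-at ℓ (attachment (B ℓ) w)

    D : V → ℕ
    D w = ∏ˡ ls (factor w)

    D-positive : ∀ w → 1 ≤ D w
    D-positive w = ∏ˡ-positive ls (factor w) (λ ℓ → diff-at-positive ℓ (attachment (B ℓ) w))

    -- A common length, long enough for every sumset along an edge to be an AP-set.
    L : ℕ
    L = 3 + ∑[ w < n G ] D w

    glued : V → AP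
    glued w = record { start = 2 ^ toℕ w ; diff = D w ; len = L
                     ; diff≥1 = D-positive w ; len≥3 = s≤s (s≤s (s≤s z≤n)) }

    listed : ∀ {ℓ} → ℓ ∈L ls → IsBlock G (B ℓ)
    listed ℓ∈ = listed⇒block (subst (_ ∈L_) Bs≡ (∈-map⁺ B ℓ∈))

    factor-own : ∀ ℓ {x} (x∈ : x ∈ B ℓ) → factor x ℓ ≡ diff-in ℓ x∈
    factor-own ℓ x∈ = trans (cong (diff-at ℓ) (attachment-in (B ℓ) x∈)) (diff-at-∈ ℓ x∈)

    factor-edge : ∀ {ℓ ℓ'} → ℓ ∈L ls → ℓ' ∈L ls → B ℓ' ≢ B ℓ →
                  ∀ {u v} → u ∈ B ℓ → v ∈ B ℓ → Adj G u v → factor u ℓ' ≡ factor v ℓ'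
    factor-edge {ℓ} {ℓ'} ℓ∈ ℓ'∈ B≢ u∈ v∈ a =
      cong (diff-at ℓ') (attachment-edge (B ℓ') (B ℓ) (listed ℓ'∈) (listed ℓ∈) B≢ u∈ v∈ a)

    edge-cofactor : ∀ {ℓ} → ℓ ∈L ls → ∀ {u v} (u∈ : u ∈ B ℓ) (v∈ : v ∈ B ℓ) → Adj G u v →
      Σ ℕ λ c → 1 ≤ c × D u ≡ c * diff-in ℓ u∈ × D v ≡ c * diff-in ℓ v∈
    edge-cofactor {ℓ} ℓ∈ {u} {v} u∈ v∈ a
      with c , c≥1 , Du , Dv ← ∏ˡ-cofactor B ls (factor u) (factor v)
                                 (subst Unique (≡-sym Bs≡) (proj₂ (proj₂ blocks))) ℓ∈
                                 (λ ℓ'∈ B≢ → factor-edge ℓ∈ ℓ'∈ B≢ u∈ v∈ a)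
                                 (λ ℓ' → diff-at-positive ℓ' (attachment (B ℓ') u)) =
      c , c≥1 , trans Du (cong (c *_) (factor-own ℓ u∈)) , trans Dv (cong (c *_) (factor-own ℓ v∈))

    block-of-edge : ∀ {u v} → Adj G u v → Σ BlockLabelling λ ℓ → ℓ ∈L ls × u ∈ B ℓ × v ∈ B ℓ
    block-of-edge {u} {v} a with B₀ , block₀ , u∈ , v∈ ← edge-block u v a
      with ℓ , ℓ∈ , refl ← ∈-map⁻ B (subst (B₀ ∈L_) (≡-sym Bs≡) (proj₁ (proj₂ blocks) B₀ block₀)) =
      ℓ , ℓ∈ , u∈ , v∈

    quotient≤L : ∀ k u v → D v ≡ k * D u → k ≤ L
    quotient≤L k u v Dv≡ = ≤-trans (m≤m*n k (D u) ⦃ >-nonZero (D-positive u) ⦄)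
      (≤-trans (≤-reflexive (≡-sym Dv≡)) (≤-trans (∑-term (n G) D v) (m≤n+m _ 3)))

    -- Along an edge the glued sumset is an AP-set: the block labelling makes one difference
    -- divide the other, the common cofactor preserves this, and L is long enough.
    glued-edgeAP : ∀ u v → Adj G u v → IsAPSet (⟦ glued u ⟧ ⊕ ⟦ glued v ⟧)
    glued-edgeAP u v a with ℓ , ℓ∈ , u∈ , v∈ ← block-of-edge a
      with c , _ , Du , Dv ← edge-cofactor ℓ∈ u∈ v∈ a
      with sumAP⇒diff∣diff (f (F ℓ) (idx (B ℓ) u∈)) (f (F ℓ) (idx (B ℓ) v∈))
             (edgeAP (F ℓ) _ _ (≢⇒complete-adj _ (idx-≢ (B ℓ) u∈ v∈ (adj⇒≢ a))))
    ... | inj₁ (divides k b≡ka) = sumAP-of-multiple (glued u) (glued v) k Dv≡ (quotient≤L k u v Dv≡)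
      where Dv≡ = scale-quotient c _ _ k Du Dv b≡ka
    ... | inj₂ (divides k a≡kb) = sumAP-of-multiple' (glued u) (glued v) k Du≡ (quotient≤L k v u Du≡)
      where Du≡ = scale-quotient c _ _ k Dv Du a≡kb

    glued-vinj : ∀ u v → u ≢ v → ¬ (⟦ glued u ⟧ ≐ ⟦ glued v ⟧)
    glued-vinj u v u≢v e = u≢v (Finₚ.toℕ-injective (2^-injective _ _ (≐⇒start≡ (glued u) (glued v) e)))

    -- Distinct edges have distinct minima 2^u + 2^v, since powers of two form a Sidon set.
    glued-einj : ∀ u v u' v' → Adj G u v → Adj G u' v' → ¬ ((u ≡ u' × v ≡ v') ⊎ (u ≡ v' × v ≡ u')) →
                 ¬ ((⟦ glued u ⟧ ⊕ ⟦ glued v ⟧) ≐ (⟦ glued u' ⟧ ⊕ ⟦ glued v' ⟧))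
    glued-einj u v u' v' a a' different e with sidon (toℕ u) (toℕ v) (toℕ u') (toℕ v')
      (adj⇒≢ a ∘ Finₚ.toℕ-injective) (adj⇒≢ a' ∘ Finₚ.toℕ-injective)
      (⊕≐⇒start≡ (glued u) (glued v) (glued u') (glued v') e)
    ... | inj₁ (e₁ , e₂) = different (inj₁ (Finₚ.toℕ-injective e₁ , Finₚ.toℕ-injective e₂))
    ... | inj₂ (e₁ , e₂) = different (inj₂ (Finₚ.toℕ-injective e₁ , Finₚ.toℕ-injective e₂))

    glued-IASI : ArithIASI G
    glued-IASI = record { f = glued ; vinj = glued-vinj ; edgeAP = glued-edgeAP ; einj = glued-einj }

    -- On each block the glued labelling has the same defects as the block labelling,
    -- since along each edge the differences are scaled by a common cofactor.
    block-defects : ∀ {ℓ} → ℓ ∈L ls → defects (glued ∘ elt (B ℓ)) (edges (complete ∣ B ℓ ∣)) ≡ d ℓ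
    block-defects {ℓ} ℓ∈ = trans (defects-edge-cong (complete ∣ B ℓ ∣) (glued ∘ elt (B ℓ)) (f (F ℓ)) edge-defect) (≡-sym (d≡ ℓ))
      where
      edge-defect : ∀ i j → Adj (complete ∣ B ℓ ∣) i j →
                    defect (glued (elt (B ℓ) i)) (glued (elt (B ℓ) j)) ≡ defect (f (F ℓ) i) (f (F ℓ) j)
      edge-defect i j a with c , c≥1 , Du , Dv ← edge-cofactor ℓ∈ (elt∈ (B ℓ) i) (elt∈ (B ℓ) j)
                                              (block-graph _ (listed ℓ∈) _ _ (elt∈ (B ℓ) i) (elt∈ (B ℓ) j)
                                                 (complete-adj⇒≢ _ a ∘ elt-injective (B ℓ)))
        = defect-scale c≥1 (trans Du (cong (λ q → c * diff (f (F ℓ) q)) (idx-elt (B ℓ) i _)))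
                           (trans Dv (cong (λ q → c * diff (f (F ℓ) q)) (idx-elt (B ℓ) j _)))

    glued-count : ∀ ds → ∑ˡ ls d ≡ sum ds → NPCount glued-IASI (edges G) (sum ds)
    glued-count ds ∑≡ = subst (NPCount glued-IASI (edges G)) total (npcount-defects glued-IASI (edges G))
      where
      total : defects glued (edges G) ≡ sum ds
      total = begin
        defects glued (edges G)        ≡⟨ defects-decompose glued ⟩
        ∑ˡ Bs block-count              ≡⟨ cong (λ Bs' → ∑ˡ Bs' block-count) (≡-sym Bs≡) ⟩
        ∑ˡ (map B ls) block-count      ≡⟨ ∑ˡ-map B ls block-count ⟩
        ∑ˡ ls (block-count ∘ B)        ≡⟨ ∑ˡ-cong ls block-defects ⟩
        ∑ˡ ls d                        ≡⟨ ∑≡ ⟩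
        sum ds ∎
        where
        open ≡-Reasoning
        block-count : Subset (n G) → ℕ
        block-count B' = defects (glued ∘ elt B') (edges (complete ∣ B' ∣))

theorem3p9 : (G : Graph) → IsBlockGraph G →
    (Bs : List (Subset (n G))) → IsBlockList G Bs →
    (ds : List ℕ) → Pointwise (λ B d → IsDispensingNumber (complete ∣ B ∣) d) Bs ds →
    IsDispensingNumber G (sum ds)
theorem3p9 G block-graph Bs blocks ds ϑs = attained , lower-bound ds ϑs
  where
  open BlockDecomposition block-graph Bs blocks
  attained : Σ (ArithIASI G) λ F → NPCount F (edges G) (sum ds)
  attained with ls , Bs≡ , ∑≡ ← optimal-labellings ds ϑs =
    Gluing.glued-IASI ls Bs≡ , Gluing.glued-count ls Bs≡ ds ∑≡
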